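{- Let $G^\sigma$ be a signed graph whose underlying graph $G$ is connected, and suppose that all but one of the eigenvalues of its adjacency matrix (counted with multiplicity) are equal to $\pm 1$. Then $G^\sigma$ or its negative $G^{ -\sigma}$ is switching isomorphic with the unsigned complete graph $K_n$ for some $n\neq 2$.
   Context: A signed graph $G^\sigma$ is a finite simple graph $G$ with a signature $\sigma:E(G)\to\{ -1,+1\}$; its adjacency matrix $A$ has $A_{uv}=\sigma(\{u,v\})$ for edges and $0$ otherwise. The negative $G^{ -\sigma}$ has adjacency matrix $-A$. Switching with respect to a vertex subset $X$ changes the sign of every edge between $X$ and $V\setminus X$. Two signed graphs are switching isomorphic if one can be switched into an isomorphic copy of the other. An unsigned graph is regarded as the signed graph with all edges positive. -}

module Defs where

open import Data.Nat using (ℕ; zero; suc)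
open import Data.Integer using (ℤ; +_; -_; _-_; _+_; _*_; _^_)
open import Data.Fin using (Fin; zero; suc; punchIn; toℕ)
open import Data.Fin.Properties using (_≟_)
open import Data.Bool using (Bool; true; false; if_then_else_; not)
open import Data.Sign using (Sign) renaming (+ to pos; - to neg; opposite to flip)
open import Data.Product using (Σ; ∃; _×_; _,_)
open import Function.Bundles using (_⤖_; Bijection)
open import Relation.Binary.PropositionalEquality using (_≡_; sym)
open import Relation.Nullary using (yes; no)
open import Data.Empty using (⊥-elim)
open import Relation.Nullary.Decidable using (⌊_⌋)

-- A signed graph on vertex set Fin n: a finite simple graph (symmetric,
-- irreflexive adjacency) together with a signature on its edges
-- (given as a symmetric sign function; only its values on edges matter).
record SignedGraph (n : ℕ) : Set where
  field
    adj      : Fin n → Fin n → Bool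
    adj-sym  : ∀ u v → adj u v ≡ adj v u
    adj-irr  : ∀ u → adj u u ≡ false
    sgn      : Fin n → Fin n → Sign
    sgn-sym  : ∀ u v → sgn u v ≡ sgn v u
open SignedGraph public

signToℤ : Sign → ℤ
signToℤ pos = + 1
signToℤ neg = - (+ 1)

adjMatrix : ∀ {n} → SignedGraph n → Fin n → Fin n → ℤ
adjMatrix G u v = if adj G u v then signToℤ (sgn G u v) else + 0

negative : ∀ {n} → SignedGraph n → SignedGraph n
negative G = record
  { adj = adj G ; adj-sym = adj-sym G ; adj-irr = adj-irr G
  ; sgn = λ u v → flip (sgn G u v)
  ; sgn-sym = λ u v → cong′ (sgn-sym G u v) }
  where
  cong′ : ∀ {a b : Sign} → a ≡ b → flip a ≡ flip b
  cong′ _≡_.refl = _≡_.refl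

private
  ≟-sym : ∀ {m} (u v : Fin m) → not ⌊ u ≟ v ⌋ ≡ not ⌊ v ≟ u ⌋
  ≟-sym u v with u ≟ v | v ≟ u
  ... | yes _ | yes _ = _≡_.refl
  ... | no _  | no _  = _≡_.refl
  ... | yes p | no q  = ⊥-elim (q (sym p))
  ... | no p  | yes q = ⊥-elim (p (sym q))
  ≟-irr : ∀ {m} (u : Fin m) → not ⌊ u ≟ u ⌋ ≡ false
  ≟-irr u with u ≟ u
  ... | yes _ = _≡_.refl
  ... | no p  = ⊥-elim (p _≡_.refl)

completeGraph : (m : ℕ) → SignedGraph m
completeGraph m = record
  { adj = λ u v → not ⌊ u ≟ v ⌋ ; adj-sym = ≟-sym ; adj-irr = ≟-irr
  ; sgn = λ _ _ → pos ; sgn-sym = λ _ _ → _≡_.refl }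

-- Switching with respect to X ⊆ V (X given by its indicator): the sign of
-- every edge between X and V \ X is changed.
switchSign : Bool → Sign
switchSign true  = neg
switchSign false = pos

switchedMatrix : ∀ {n} → (Fin n → Bool) → SignedGraph n → Fin n → Fin n → ℤ
switchedMatrix X G u v =
  signToℤ (switchSign (X u)) * signToℤ (switchSign (X v)) * adjMatrix G u v

SwitchingIsomorphic : ∀ {n m} → SignedGraph n → SignedGraph m → Set
SwitchingIsomorphic {n} {m} G H =
  Σ (Fin n → Bool) λ X → Σ (Fin n ⤖ Fin m) λ f →
    ∀ u v → switchedMatrix X G u v ≡ adjMatrix H (Bijection.to f u) (Bijection.to f v)

data Reachable {n : ℕ} (G : SignedGraph n) : Fin n → Fin n → Set where
  here : ∀ {u} → Reachable G u u
  step : ∀ {u v w} → adj G u v ≡ true → Reachable G v w → Reachable G u w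

Connected : ∀ {n} → SignedGraph n → Set
Connected {n} G = ∀ (u v : Fin n) → Reachable G u v

sumFin : ∀ {n} → (Fin n → ℤ) → ℤ
sumFin {zero}  f = + 0
sumFin {suc n} f = f zero + sumFin (λ i → f (suc i))

det : ∀ {n} → (Fin n → Fin n → ℤ) → ℤ
det {zero}  M = + 1
det {suc n} M = sumFin λ j →
  (- (+ 1)) ^ toℕ j * M zero j * det (λ i k → M (suc i) (punchIn j k))

charPoly : ∀ {n} → (Fin n → Fin n → ℤ) → ℤ → ℤ
charPoly M x = det λ i j → (if ⌊ i ≟ j ⌋ then x else + 0) - M i j

{-# OPTIONS --safe #-}
-- Write A for the adjacency matrix, N = 1 + a + b, and B = A² − I, whose diagonal lists the
-- degrees minus one. The characteristic polynomial of the zero-diagonal matrix A has coefficient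
-- −½ trace A² at x^(N−2); comparing with (x − μ)(x − 1)ᵃ(x + 1)ᵇ gives trace B = μ² − 1 ≠ 0.
-- By Cayley–Hamilton, (A − μ)(A² − I) is nilpotent, hence zero as A is symmetric, so that
-- B² = (μ² − 1) B: every 2 × 2 principal minor of B vanishes. Along an edge uv this forces
-- B u u = B v v, and then equality in ∣(A²) u v∣ ≤ B u u says that u and v have the same other
-- neighbours, with A u x A x v independent of x. A connected such graph is complete, all its
-- triangles through a fixed vertex have the same sign ε, and switching turns it into ε K_N;
-- N = 2 is excluded because K₂ has B = 0.
module Submission where

open import Defs
open import Data.Bool using (true; false; if_then_else_)
open import Data.Fin using (Fin; zero; suc; punchIn; punchOut; toℕ)
open import Data.Fin.Properties using (_≟_; suc-injective; punchInᵢ≢i; punchIn-punchOut)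
open import Data.Integer using (ℤ; nonNegative; +_; -_; _-_; _+_; _*_; _^_; 0ℤ; 1ℤ; _≤_; +≤+; +[1+_]; -[1+_]; ∣_∣)
import Data.Integer.Properties as ℤ
open import Data.Integer.Tactic.RingSolver using (solve-∀)
open import Data.List using (List; []; _∷_; length)
open import Data.Nat using (ℕ; zero; suc; z≤n; s≤s)
import Data.Nat as ℕ
import Data.Nat.Properties as ℕ
open import Data.Product using (Σ; ∃; _×_; _,_; proj₁; proj₂)
open import Data.Sign using () renaming (+ to pos; - to neg)
open import Data.Sum using (_⊎_; inj₁; inj₂)
open import Function using (_∘_; _$_)
open import Function.Construct.Identity using (⤖-id)
open import Relation.Binary.Bundles using (Setoid)
open import Relation.Binary.PropositionalEquality
import Relation.Binary.Reasoning.Setoid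
open import Relation.Nullary using (Dec; yes; no; ¬_; contradiction)
open import Relation.Nullary.Decidable using (⌊_⌋)
open import Algebra.Properties.Semiring.Sum ℤ.+-*-semiring
  using (sum; sum-cong-≗; ∑-distrib-+; ∑-comm; sum-remove; *-distribˡ-sum; *-distribʳ-sum; sum-replicate-zero)

-- Finite sums

sumFin≡sum : ∀ {n} (f : Fin n → ℤ) → sumFin f ≡ sum f
sumFin≡sum {zero}  f = refl
sumFin≡sum {suc n} f = cong (_+_ (f zero)) (sumFin≡sum (f ∘ suc))

sum-zero : ∀ {n} (f : Fin n → ℤ) → (∀ i → f i ≡ 0ℤ) → sum f ≡ 0ℤ
sum-zero {n} f f≗0 = trans (sum-cong-≗ f≗0) (sum-replicate-zero n)

neg-distrib-sum : ∀ {n} (f : Fin n → ℤ) → - sum f ≡ sum (λ i → - f i)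
neg-distrib-sum f = begin
  - sum f                       ≡⟨ ℤ.-1*i≡-i (sum f) ⟨
  - 1ℤ * sum f                  ≡⟨ *-distribˡ-sum (- 1ℤ) f ⟩
  sum (λ i → - 1ℤ * f i)        ≡⟨ sum-cong-≗ (ℤ.-1*i≡-i ∘ f) ⟩
  sum (λ i → - f i)             ∎
  where open ≡-Reasoning

sum-distrib-minus : ∀ {n} (f g : Fin n → ℤ) → sum (λ i → f i - g i) ≡ sum f - sum g
sum-distrib-minus f g = begin
  sum (λ i → f i - g i)         ≡⟨ ∑-distrib-+ f (λ i → - g i) ⟩
  sum f + sum (λ i → - g i)     ≡⟨ cong (_+_ (sum f)) (neg-distrib-sum g) ⟨
  sum f - sum g                 ∎
  where open ≡-Reasoning

sum-ones : ∀ n → sum {n} (λ _ → 1ℤ) ≡ + n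
sum-ones zero    = refl
sum-ones (suc n) = cong (_+_ 1ℤ) (sum-ones n)

sum-product : ∀ {m n} (f : Fin m → ℤ) (g : Fin n → ℤ) →
  sum (λ i → sum (λ j → f i * g j)) ≡ sum f * sum g
sum-product f g = begin
  sum (λ i → sum (λ j → f i * g j))  ≡⟨ sum-cong-≗ (λ i → *-distribˡ-sum (f i) g) ⟨
  sum (λ i → f i * sum g)            ≡⟨ *-distribʳ-sum (sum g) f ⟨
  sum f * sum g                      ∎
  where open ≡-Reasoning

sum-single : ∀ {n} (i : Fin n) (f : Fin n → ℤ) → (∀ j → j ≢ i → f j ≡ 0ℤ) → sum f ≡ f i
sum-single {suc n} i f vanish = begin
  sum f                              ≡⟨ sum-remove {i = i} f ⟩
  f i + sum (f ∘ punchIn i)          ≡⟨ cong (_+_ (f i)) (sum-zero _ (λ k → vanish _ (punchInᵢ≢i i k))) ⟩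
  f i + 0ℤ                           ≡⟨ ℤ.+-identityʳ (f i) ⟩
  f i                                ∎
  where open ≡-Reasoning

δ : ∀ {n} → Fin n → Fin n → ℤ
δ i j = if ⌊ i ≟ j ⌋ then 1ℤ else 0ℤ

δ-refl : ∀ {n} (i : Fin n) → δ i i ≡ 1ℤ
δ-refl i with i ≟ i
... | yes _  = refl
... | no i≢i = contradiction refl i≢i

δ-≢ : ∀ {n} {i j : Fin n} → i ≢ j → δ i j ≡ 0ℤ
δ-≢ {i = i} {j} i≢j with i ≟ j
... | yes i≡j = contradiction i≡j i≢j
... | no _    = refl

δ-sym : ∀ {n} (i j : Fin n) → δ i j ≡ δ j i
δ-sym i j with i ≟ j
... | yes refl = sym (δ-refl i)
... | no i≢j   = sym (δ-≢ (i≢j ∘ sym))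

sum-δˡ : ∀ {n} (i : Fin n) (f : Fin n → ℤ) → sum (λ j → δ i j * f j) ≡ f i
sum-δˡ i f = begin
  sum (λ j → δ i j * f j)  ≡⟨ sum-single i _ (λ j j≢i → trans (cong (_* f j) (δ-≢ (j≢i ∘ sym))) (ℤ.*-zeroˡ (f j))) ⟩
  δ i i * f i              ≡⟨ cong (_* f i) (δ-refl i) ⟩
  1ℤ * f i                 ≡⟨ ℤ.*-identityˡ (f i) ⟩
  f i                      ∎
  where open ≡-Reasoning

sum-δʳ : ∀ {n} (i : Fin n) (f : Fin n → ℤ) → sum (λ j → f j * δ j i) ≡ f i
sum-δʳ i f = trans (sum-cong-≗ (λ j → trans (ℤ.*-comm (f j) _) (cong (_* f j) (δ-sym j i)))) (sum-δˡ i f)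

sum-nonneg : ∀ {n} (f : Fin n → ℤ) → (∀ i → 0ℤ ≤ f i) → 0ℤ ≤ sum f
sum-nonneg {zero}  f f≥0 = ℤ.≤-refl
sum-nonneg {suc n} f f≥0 = ℤ.+-mono-≤ (f≥0 zero) (sum-nonneg (f ∘ suc) (f≥0 ∘ suc))

term≤sum : ∀ {n} (f : Fin n → ℤ) → (∀ i → 0ℤ ≤ f i) → ∀ i → f i ≤ sum f
term≤sum f f≥0 zero    = ℤ.i≤i+j (f zero) _ {{nonNegative (sum-nonneg (f ∘ suc) (f≥0 ∘ suc))}}
term≤sum f f≥0 (suc i) = ℤ.≤-trans (term≤sum (f ∘ suc) (f≥0 ∘ suc) i) (ℤ.i≤j+i _ (f zero) {{nonNegative (f≥0 zero)}})

sum-nonneg≡0 : ∀ {n} (f : Fin n → ℤ) → (∀ i → 0ℤ ≤ f i) → sum f ≡ 0ℤ → ∀ i → f i ≡ 0ℤ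
sum-nonneg≡0 f f≥0 Σf≡0 i = ℤ.≤-antisym (subst (f i ≤_) Σf≡0 (term≤sum f f≥0 i)) (f≥0 i)

square-nonneg : ∀ x → 0ℤ ≤ x * x
square-nonneg (+ zero)   = ℤ.≤-refl
square-nonneg +[1+ n ]   = +≤+ z≤n
square-nonneg -[1+ n ]   = +≤+ z≤n

square≡0 : ∀ {x} → x * x ≡ 0ℤ → x ≡ 0ℤ
square≡0 {x} x²≡0 with ℤ.i*j≡0⇒i≡0∨j≡0 x x²≡0
... | inj₁ x≡0 = x≡0
... | inj₂ x≡0 = x≡0

sum-squares≡0 : ∀ {n} (f : Fin n → ℤ) → sum (λ i → f i * f i) ≡ 0ℤ → ∀ i → f i ≡ 0ℤ
sum-squares≡0 f Σf²≡0 i = square≡0 (sum-nonneg≡0 _ (λ j → square-nonneg (f j)) Σf²≡0 i)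

private
  double-nonneg : ∀ x → 0ℤ ≤ + 2 * x → 0ℤ ≤ x
  double-nonneg (+ n) _ = +≤+ z≤n

-- Lagrange's identity: the double sum of (f x g y − f y g x)² is 2 (F G − P²).
cauchy-schwarz : ∀ {n} (f g : Fin n → ℤ) →
  0ℤ ≤ sum (λ i → f i * f i) * sum (λ i → g i * g i) - sum (λ i → f i * g i) * sum (λ i → f i * g i)
cauchy-schwarz f g = double-nonneg _ (subst (0ℤ ≤_) lagrange
  (sum-nonneg _ (λ x → sum-nonneg _ (λ y → square-nonneg (f x * g y - f y * g x)))))
  where
  open ≡-Reasoning
  f² g² fg : Fin _ → ℤ
  f² i = f i * f i
  g² i = g i * g i
  fg i = f i * g i
  F = sum f²
  G = sum g²
  P = sum fg
  expand : ∀ fx gx fy gy → (fx * gy - fy * gx) * (fx * gy - fy * gx)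
                           ≡ fx * fx * (gy * gy) + gx * gx * (fy * fy) - + 2 * (fx * gx * (fy * gy))
  expand = solve-∀
  collect : ∀ F G P → F * G + G * F - + 2 * (P * P) ≡ + 2 * (F * G - P * P)
  collect = solve-∀
  sum₂-distrib : ∀ (a b c : Fin _ → Fin _ → ℤ) →
    sum (λ x → sum (λ y → a x y + b x y - + 2 * c x y))
    ≡ sum (λ x → sum (a x)) + sum (λ x → sum (b x)) - + 2 * sum (λ x → sum (c x))
  sum₂-distrib a b c = begin
    sum (λ x → sum (λ y → a x y + b x y - + 2 * c x y))
      ≡⟨ sum-cong-≗ (λ x → sum-distrib-combination (a x) (b x) (c x)) ⟩
    sum (λ x → sum (a x) + sum (b x) - + 2 * sum (c x))
      ≡⟨ sum-distrib-combination (λ x → sum (a x)) (λ x → sum (b x)) (λ x → sum (c x)) ⟩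
    sum (λ x → sum (a x)) + sum (λ x → sum (b x)) - + 2 * sum (λ x → sum (c x)) ∎
    where
    sum-distrib-combination : ∀ {m} (u v w : Fin m → ℤ) →
      sum (λ i → u i + v i - + 2 * w i) ≡ sum u + sum v - + 2 * sum w
    sum-distrib-combination u v w = begin
      sum (λ i → u i + v i - + 2 * w i)      ≡⟨ sum-distrib-minus (λ i → u i + v i) (λ i → + 2 * w i) ⟩
      sum (λ i → u i + v i) - sum (λ i → + 2 * w i)
        ≡⟨ cong₂ _-_ (∑-distrib-+ u v) (sym (*-distribˡ-sum (+ 2) w)) ⟩
      sum u + sum v - + 2 * sum w            ∎
  lagrange : sum (λ x → sum (λ y → (f x * g y - f y * g x) * (f x * g y - f y * g x)))
             ≡ + 2 * (F * G - P * P)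
  lagrange = begin
    sum (λ x → sum (λ y → (f x * g y - f y * g x) * (f x * g y - f y * g x)))
      ≡⟨ sum-cong-≗ (λ x → sum-cong-≗ (λ y → expand (f x) (g x) (f y) (g y))) ⟩
    sum (λ x → sum (λ y → f x * f x * (g y * g y) + g x * g x * (f y * f y) - + 2 * (f x * g x * (f y * g y))))
      ≡⟨ sum₂-distrib (λ x y → f x * f x * (g y * g y)) (λ x y → g x * g x * (f y * f y))
                      (λ x y → f x * g x * (f y * g y)) ⟩
    sum (λ x → sum (λ y → f x * f x * (g y * g y))) + sum (λ x → sum (λ y → g x * g x * (f y * f y)))
      - + 2 * sum (λ x → sum (λ y → f x * g x * (f y * g y)))
      ≡⟨ cong₂ _-_ (cong₂ _+_ (sum-product f² g²) (sum-product g² f²)) (cong (+ 2 *_) (sum-product fg fg)) ⟩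
    F * G + G * F - + 2 * (P * P)
      ≡⟨ collect F G P ⟩
    + 2 * (F * G - P * P) ∎

-- Determinants

Mat : ℕ → Set
Mat n = Fin n → Fin n → ℤ

altSign : ℕ → ℤ
altSign m = (- 1ℤ) ^ m

altSign-+ : ∀ m k → altSign (m ℕ.+ k) ≡ altSign m * altSign k
altSign-+ = ℤ.^-distribˡ-+-* (- 1ℤ)

altSign-suc : ∀ m → altSign (suc m) ≡ - altSign m
altSign-suc m = ℤ.-1*i≡-i (altSign m)

minor : ∀ {n} {X : Set} → (Fin (suc n) → Fin (suc n) → X) → Fin (suc n) → Fin (suc n) → Fin n → Fin n → X
minor M k j r t = M (punchIn k r) (punchIn j t)

cofactor : ∀ {n} → Mat (suc n) → Fin (suc n) → Fin (suc n) → ℤ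
cofactor M k j = altSign (toℕ k ℕ.+ toℕ j) * det (minor M k j)

det-expand₀ : ∀ {n} (M : Mat (suc n)) →
  det M ≡ sum (λ j → altSign (toℕ j) * M zero j * det (minor M zero j))
det-expand₀ M = sumFin≡sum (λ j → altSign (toℕ j) * M zero j * det (minor M zero j))

det-cong : ∀ {n} {M N : Mat n} → (∀ i j → M i j ≡ N i j) → det M ≡ det N
det-cong {zero}  M≈N = refl
det-cong {suc n} M≈N = sumFin-cong (λ j → cong₂ (λ x y → altSign (toℕ j) * x * y)
                                         (M≈N zero j) (det-cong (λ i k → M≈N (suc i) (punchIn j k))))
  where
  sumFin-cong : ∀ {f g : Fin _ → ℤ} → (∀ j → f j ≡ g j) → sumFin f ≡ sumFin g
  sumFin-cong {f} {g} f≗g = trans (sumFin≡sum f) (trans (sum-cong-≗ f≗g) (sym (sumFin≡sum g)))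

-- The position of b among the indices other than a (a junk value when a ≡ b).
punchOutᵗ : ∀ {n} → Fin (suc (suc n)) → Fin (suc (suc n)) → Fin (suc n)
punchOutᵗ zero    zero    = zero
punchOutᵗ zero    (suc b) = b
punchOutᵗ (suc a) zero    = zero
punchOutᵗ {zero}  (suc a) (suc b) = zero
punchOutᵗ {suc n} (suc a) (suc b) = suc (punchOutᵗ a b)

punchOutᵗ-punchIn : ∀ {n} (a : Fin (suc (suc n))) (l : Fin (suc n)) → punchOutᵗ a (punchIn a l) ≡ l
punchOutᵗ-punchIn zero    l       = refl
punchOutᵗ-punchIn (suc a) zero    = refl
punchOutᵗ-punchIn {suc n} (suc a) (suc l) = cong suc (punchOutᵗ-punchIn a l)

punchIn-punchOutᵗ-comm : ∀ {n} (a b : Fin (suc (suc n))) → a ≢ b → ∀ t →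
  punchIn a (punchIn (punchOutᵗ a b) t) ≡ punchIn b (punchIn (punchOutᵗ b a) t)
punchIn-punchOutᵗ-comm zero    zero    a≢b t = contradiction refl a≢b
punchIn-punchOutᵗ-comm zero    (suc b) a≢b t = refl
punchIn-punchOutᵗ-comm (suc a) zero    a≢b t = refl
punchIn-punchOutᵗ-comm {zero}  (suc zero) (suc zero) a≢b t = contradiction refl a≢b
punchIn-punchOutᵗ-comm {suc n} (suc a) (suc b) a≢b zero    = refl
punchIn-punchOutᵗ-comm {suc n} (suc a) (suc b) a≢b (suc t) =
  cong suc (punchIn-punchOutᵗ-comm a b (a≢b ∘ cong suc) t)

pairSign : ∀ {n} → Fin (suc (suc n)) → Fin (suc (suc n)) → ℤ
pairSign a b = altSign (toℕ a ℕ.+ toℕ (punchOutᵗ a b))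

pairSign-punchIn : ∀ {n} (a : Fin (suc (suc n))) l → pairSign a (punchIn a l) ≡ altSign (toℕ a ℕ.+ toℕ l)
pairSign-punchIn a l = cong (λ k → altSign (toℕ a ℕ.+ toℕ k)) (punchOutᵗ-punchIn a l)

private
  pairIndex-parity : ∀ {n} (a b : Fin (suc (suc n))) → a ≢ b →
    (toℕ b ℕ.+ toℕ (punchOutᵗ b a) ≡ suc (toℕ a ℕ.+ toℕ (punchOutᵗ a b))) ⊎
    (toℕ a ℕ.+ toℕ (punchOutᵗ a b) ≡ suc (toℕ b ℕ.+ toℕ (punchOutᵗ b a)))
  pairIndex-parity zero    zero    a≢b = contradiction refl a≢b
  pairIndex-parity zero    (suc b) a≢b = inj₁ (ℕ.+-identityʳ _)
  pairIndex-parity (suc a) zero    a≢b = inj₂ (ℕ.+-identityʳ _)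
  pairIndex-parity {zero}  (suc zero) (suc zero) a≢b = contradiction refl a≢b
  pairIndex-parity {suc n} (suc a) (suc b) a≢b with pairIndex-parity a b (a≢b ∘ cong suc)
  ... | inj₁ e = inj₁ (cong suc (trans (ℕ.+-suc _ _) (cong suc (trans e (sym (ℕ.+-suc _ _))))))
  ... | inj₂ e = inj₂ (cong suc (trans (ℕ.+-suc _ _) (cong suc (trans e (sym (ℕ.+-suc _ _))))))

pairSign-antisym : ∀ {n} (a b : Fin (suc (suc n))) → a ≢ b → pairSign a b ≡ - pairSign b a
pairSign-antisym a b a≢b with pairIndex-parity a b a≢b
... | inj₁ e = trans (sym (ℤ.neg-involutive _)) (cong -_ (trans (sym (altSign-suc (toℕ a ℕ.+ toℕ (punchOutᵗ a b)))) (cong altSign (sym e))))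
... | inj₂ e = trans (cong altSign e) (altSign-suc (toℕ b ℕ.+ toℕ (punchOutᵗ b a)))

-- Expansion of a determinant along two rows f and g, where D a b stands for the minor of the
-- remaining rows without the columns a and b.
module _ {n} (D : Fin (suc (suc n)) → Fin (suc (suc n)) → ℤ) where
  open ≡-Reasoning

  pairEntry : (f g : Fin (suc (suc n)) → ℤ) → Fin (suc (suc n)) → Fin (suc n) → ℤ
  pairEntry f g j l = altSign (toℕ j ℕ.+ toℕ l) * (f j * g (punchIn j l) * D j (punchIn j l))

  pairSum : (f g : Fin (suc (suc n)) → ℤ) → ℤ
  pairSum f g = sum λ j → sum (pairEntry f g j)

  private
    pairTerm : (f g : Fin (suc (suc n)) → ℤ) → Fin (suc (suc n)) → Fin (suc (suc n)) → ℤ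
    pairTerm f g a b with a ≟ b
    ... | yes _ = 0ℤ
    ... | no _  = pairSign a b * (f a * g b * D a b)

    pairTerm-diag : ∀ f g a → pairTerm f g a a ≡ 0ℤ
    pairTerm-diag f g a with a ≟ a
    ... | yes _  = refl
    ... | no a≢a = contradiction refl a≢a

    pairTerm-punchIn : ∀ f g j l → pairTerm f g j (punchIn j l) ≡ pairEntry f g j l
    pairTerm-punchIn f g j l with j ≟ punchIn j l
    ... | yes j≡ = contradiction (sym j≡) (punchInᵢ≢i j l)
    ... | no _   = cong (_* (f j * g (punchIn j l) * D j (punchIn j l))) (pairSign-punchIn j l)

    pairTerm-antisym : (∀ a b → a ≢ b → D a b ≡ D b a) → ∀ f g a b → pairTerm f g a b ≡ - pairTerm g f b a
    pairTerm-antisym D-sym f g a b with a ≟ b | b ≟ a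
    ... | yes _   | yes _   = refl
    ... | yes a≡b | no b≢a  = contradiction (sym a≡b) b≢a
    ... | no a≢b  | yes b≡a = contradiction (sym b≡a) a≢b
    ... | no a≢b  | no _    = begin
      pairSign a b * (f a * g b * D a b)        ≡⟨ cong₂ (λ s d → s * (f a * g b * d)) (pairSign-antisym a b a≢b) (D-sym a b a≢b) ⟩
      - pairSign b a * (f a * g b * D b a)      ≡⟨ reorder (pairSign b a) (f a) (g b) (D b a) ⟩
      - (pairSign b a * (g b * f a * D b a))    ∎
      where
      reorder : ∀ s x y d → - s * (x * y * d) ≡ - (s * (y * x * d))
      reorder = solve-∀

    row≡pairTerms : ∀ f g j → sum (pairEntry f g j) ≡ sum (pairTerm f g j)
    row≡pairTerms f g j = sym (begin
      sum (pairTerm f g j)                                   ≡⟨ sum-remove {i = j} (pairTerm f g j) ⟩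
      pairTerm f g j j + sum (pairTerm f g j ∘ punchIn j)    ≡⟨ cong₂ _+_ (pairTerm-diag f g j) (sum-cong-≗ (pairTerm-punchIn f g j)) ⟩
      0ℤ + sum (pairEntry f g j)                             ≡⟨ ℤ.+-identityˡ _ ⟩
      sum (pairEntry f g j)                                  ∎)

  -- Reindexed by ordered pairs of distinct columns, the terms of pairSum f g and pairSum g f cancel.
  pairSum-antisym : (∀ a b → a ≢ b → D a b ≡ D b a) → ∀ f g → pairSum f g ≡ - pairSum g f
  pairSum-antisym D-sym f g = begin
    pairSum f g                                   ≡⟨ sum-cong-≗ (row≡pairTerms f g) ⟩
    sum (λ a → sum (pairTerm f g a))              ≡⟨ ∑-comm (pairTerm f g) ⟩
    sum (λ b → sum (λ a → pairTerm f g a b))      ≡⟨ sum-cong-≗ (λ b → sum-cong-≗ (λ a → pairTerm-antisym D-sym f g a b)) ⟩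
    sum (λ b → sum (λ a → - pairTerm g f b a))    ≡⟨ sum-cong-≗ (λ b → neg-distrib-sum (pairTerm g f b)) ⟨
    sum (λ b → - sum (pairTerm g f b))            ≡⟨ neg-distrib-sum (λ b → sum (pairTerm g f b)) ⟨
    - sum (λ b → sum (pairTerm g f b))            ≡⟨ cong -_ (sum-cong-≗ (row≡pairTerms g f)) ⟨
    - pairSum g f                                 ∎

detWithout : ∀ {n} → (Fin n → Fin (suc (suc n)) → ℤ) → Fin (suc (suc n)) → Fin (suc (suc n)) → ℤ
detWithout K a b = det (λ i t → K i (punchIn a (punchIn (punchOutᵗ a b) t)))

detWithout-sym : ∀ {n} (K : Fin n → Fin (suc (suc n)) → ℤ) a b → a ≢ b → detWithout K a b ≡ detWithout K b a
detWithout-sym K a b a≢b = det-cong (λ i t → cong (K i) (punchIn-punchOutᵗ-comm a b a≢b t))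

detWithout-punchIn : ∀ {n} (K : Fin n → Fin (suc (suc n)) → ℤ) a l →
  detWithout K a (punchIn a l) ≡ det (λ i t → K i (punchIn a (punchIn l t)))
detWithout-punchIn K a l = det-cong (λ i t → cong (λ c → K i (punchIn a (punchIn c t))) (punchOutᵗ-punchIn a l))

-- Expansion along row 0 and then, given as the hypothesis, along row k of each minor.
det-expandPair : ∀ {n} (M : Mat (suc (suc n))) (k : Fin (suc n)) →
  (∀ j → det (minor M zero j) ≡ sum (λ l → minor M zero j k l * cofactor (minor M zero j) k l)) →
  det M ≡ pairSum (λ a b → altSign (toℕ k) * detWithout (λ r → M (suc (punchIn k r))) a b) (M zero) (M (suc k))
det-expandPair M k expand-minor = begin
  det M
    ≡⟨ det-expand₀ M ⟩
  sum (λ j → altSign (toℕ j) * M zero j * det (minor M zero j))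
    ≡⟨ sum-cong-≗ (λ j → cong (altSign (toℕ j) * M zero j *_) (expand-minor j)) ⟩
  sum (λ j → altSign (toℕ j) * M zero j * sum (λ l → M (suc k) (punchIn j l) * cofactor (minor M zero j) k l))
    ≡⟨ sum-cong-≗ (λ j → trans (*-distribˡ-sum (altSign (toℕ j) * M zero j) (λ l → M (suc k) (punchIn j l) * cofactor (minor M zero j) k l)) (sum-cong-≗ (entry j))) ⟩
  pairSum D (M zero) (M (suc k)) ∎
  where
  open ≡-Reasoning
  K : Fin _ → Fin _ → ℤ
  K r = M (suc (punchIn k r))
  D : Fin _ → Fin _ → ℤ
  D a b = altSign (toℕ k) * detWithout K a b
  regroup : ∀ sj sk sl x y d → sj * x * (y * (sk * sl * d)) ≡ sj * sl * (x * y * (sk * d))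
  regroup = solve-∀
  entry : ∀ j l → altSign (toℕ j) * M zero j * (M (suc k) (punchIn j l) * cofactor (minor M zero j) k l)
                  ≡ pairEntry D (M zero) (M (suc k)) j l
  entry j l = begin
    altSign (toℕ j) * M zero j * (M (suc k) (punchIn j l) * (altSign (toℕ k ℕ.+ toℕ l) * det (λ r t → K r (punchIn j (punchIn l t)))))
      ≡⟨ cong₂ (λ s d → altSign (toℕ j) * M zero j * (M (suc k) (punchIn j l) * (s * d)))
               (altSign-+ (toℕ k) (toℕ l)) (sym (detWithout-punchIn K j l)) ⟩
    altSign (toℕ j) * M zero j * (M (suc k) (punchIn j l) * (altSign (toℕ k) * altSign (toℕ l) * detWithout K j (punchIn j l)))
      ≡⟨ regroup (altSign (toℕ j)) (altSign (toℕ k)) (altSign (toℕ l)) (M zero j) (M (suc k) (punchIn j l)) _ ⟩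
    altSign (toℕ j) * altSign (toℕ l) * (M zero j * M (suc k) (punchIn j l) * D j (punchIn j l))
      ≡⟨ cong (_* (M zero j * M (suc k) (punchIn j l) * D j (punchIn j l))) (altSign-+ (toℕ j) (toℕ l)) ⟨
    pairEntry D (M zero) (M (suc k)) j l ∎

det-expandRow : ∀ {n} (M : Mat (suc n)) (k : Fin (suc n)) → det M ≡ sum (λ j → M k j * cofactor M k j)
det-expandRow M zero = trans (det-expand₀ M) (sum-cong-≗ (λ j → reorder (altSign (toℕ j)) (M zero j) (det (minor M zero j))))
  where
  reorder : ∀ s x d → s * x * d ≡ x * (s * d)
  reorder = solve-∀
det-expandRow {suc n} M (suc k) = begin
  det M
    ≡⟨ det-expandPair M k (λ j → det-expandRow (minor M zero j) k) ⟩
  pairSum D (M zero) (M (suc k))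
    ≡⟨ pairSum-antisym D (λ a b a≢b → cong (altSign (toℕ k) *_) (detWithout-sym K a b a≢b)) (M zero) (M (suc k)) ⟩
  - pairSum D (M (suc k)) (M zero)
    ≡⟨ neg-distrib-sum (λ q → sum (pairEntry D (M (suc k)) (M zero) q)) ⟩
  sum (λ q → - sum (pairEntry D (M (suc k)) (M zero) q))
    ≡⟨ sum-cong-≗ (λ q → trans (neg-distrib-sum (pairEntry D (M (suc k)) (M zero) q)) (sym (row q))) ⟩
  sum (λ q → M (suc k) q * cofactor M (suc k) q) ∎
  where
  open ≡-Reasoning
  K : Fin n → Fin (suc (suc n)) → ℤ
  K r = M (suc (punchIn k r))
  D : Fin _ → Fin _ → ℤ
  D a b = altSign (toℕ k) * detWithout K a b
  regroup : ∀ x sk sq sp y d → x * (- (sk * sq)) * (sp * y * d) ≡ - (sq * sp * (x * y * (sk * d)))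
  regroup = solve-∀
  row : ∀ q → M (suc k) q * cofactor M (suc k) q ≡ sum (λ p → - pairEntry D (M (suc k)) (M zero) q p)
  row q = begin
    M (suc k) q * (altSign (suc (toℕ k ℕ.+ toℕ q)) * det (minor M (suc k) q))
      ≡⟨ cong₂ (λ s d → M (suc k) q * (s * d)) (trans (altSign-suc (toℕ k ℕ.+ toℕ q)) (cong -_ (altSign-+ (toℕ k) (toℕ q)))) (det-expand₀ (minor M (suc k) q)) ⟩
    M (suc k) q * (- (altSign (toℕ k) * altSign (toℕ q)) * sum (λ p → altSign (toℕ p) * M zero (punchIn q p) * det (λ r t → K r (punchIn q (punchIn p t)))))
      ≡⟨ trans (sym (ℤ.*-assoc (M (suc k) q) _ _)) (*-distribˡ-sum (M (suc k) q * (- (altSign (toℕ k) * altSign (toℕ q)))) (λ p → altSign (toℕ p) * M zero (punchIn q p) * det (λ r t → K r (punchIn q (punchIn p t))))) ⟩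
    sum (λ p → M (suc k) q * (- (altSign (toℕ k) * altSign (toℕ q))) * (altSign (toℕ p) * M zero (punchIn q p) * det (λ r t → K r (punchIn q (punchIn p t)))))
      ≡⟨ sum-cong-≗ entry ⟩
    sum (λ p → - pairEntry D (M (suc k)) (M zero) q p) ∎
    where
    entry : ∀ p → M (suc k) q * (- (altSign (toℕ k) * altSign (toℕ q))) * (altSign (toℕ p) * M zero (punchIn q p) * det (λ r t → K r (punchIn q (punchIn p t))))
                  ≡ - pairEntry D (M (suc k)) (M zero) q p
    entry p = begin
      M (suc k) q * (- (sk * sq)) * (sp * M zero (punchIn q p) * det (λ r t → K r (punchIn q (punchIn p t))))
        ≡⟨ cong (λ d → M (suc k) q * (- (sk * sq)) * (sp * M zero (punchIn q p) * d)) (detWithout-punchIn K q p) ⟨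
      M (suc k) q * (- (sk * sq)) * (sp * M zero (punchIn q p) * detWithout K q (punchIn q p))
        ≡⟨ regroup (M (suc k) q) sk sq sp (M zero (punchIn q p)) (detWithout K q (punchIn q p)) ⟩
      - (sq * sp * (M (suc k) q * M zero (punchIn q p) * D q (punchIn q p)))
        ≡⟨ cong (λ s → - (s * (M (suc k) q * M zero (punchIn q p) * D q (punchIn q p)))) (altSign-+ (toℕ q) (toℕ p)) ⟨
      - pairEntry D (M (suc k)) (M zero) q p ∎
      where
      sk = altSign (toℕ k)
      sq = altSign (toℕ q)
      sp = altSign (toℕ p)

swap₀₁ : ∀ {n} → Fin (suc (suc n)) → Fin (suc (suc n))
swap₀₁ zero          = suc zero
swap₀₁ (suc zero)    = zero
swap₀₁ (suc (suc i)) = suc (suc i)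

det-swap₀₁ : ∀ {n} (M : Mat (suc (suc n))) → det M ≡ - det (M ∘ swap₀₁)
det-swap₀₁ M = begin
  det M                                   ≡⟨ det-expandPair M zero (λ j → det-expandRow (minor M zero j) zero) ⟩
  pairSum D (M zero) (M (suc zero))       ≡⟨ pairSum-antisym D (λ a b a≢b → cong (1ℤ *_) (detWithout-sym K a b a≢b)) (M zero) (M (suc zero)) ⟩
  - pairSum D (M (suc zero)) (M zero)     ≡⟨ cong -_ (det-expandPair (M ∘ swap₀₁) zero (λ j → det-expandRow (minor (M ∘ swap₀₁) zero j) zero)) ⟨
  - det (M ∘ swap₀₁)                      ∎
  where
  open ≡-Reasoning
  K : Fin _ → Fin _ → ℤ
  K r = M (suc (suc r))
  D : Fin _ → Fin _ → ℤ
  D a b = 1ℤ * detWithout K a b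

private
  x≡-x⇒x≡0 : ∀ {x} → x ≡ - x → x ≡ 0ℤ
  x≡-x⇒x≡0 {x} x≡-x with ℤ.i*j≡0⇒i≡0∨j≡0 (+ 2) {x} (trans (double x) (trans (cong (_+_ x) x≡-x) (ℤ.+-inverseʳ x)))
    where
    double : ∀ x → + 2 * x ≡ x + x
    double = solve-∀
  ... | inj₂ x≡0 = x≡0

det-minors≡0 : ∀ {n} (M : Mat (suc n)) → (∀ j → det (minor M zero j) ≡ 0ℤ) → det M ≡ 0ℤ
det-minors≡0 {n} M minors≡0 = trans (det-expand₀ M)
  (sum-zero _ (λ j → trans (cong (altSign (toℕ j) * M zero j *_) (minors≡0 j)) (ℤ.*-zeroʳ (altSign (toℕ j) * M zero j))))

det-equalRows : ∀ {n} (M : Mat n) {i k} → i ≢ k → (∀ j → M i j ≡ M k j) → det M ≡ 0ℤ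
det-equalRow₀ : ∀ {n} (M : Mat (suc n)) k → (∀ j → M zero j ≡ M (suc k) j) → det M ≡ 0ℤ
det-equalRows M {zero}  {zero}  i≢k _ = contradiction refl i≢k
det-equalRows M {zero}  {suc k} _ rows≡ = det-equalRow₀ M k rows≡
det-equalRows M {suc i} {zero}  _ rows≡ = det-equalRow₀ M i (sym ∘ rows≡)
det-equalRows M {suc i} {suc k} i≢k rows≡ =
  det-minors≡0 M (λ j → det-equalRows (minor M zero j) (i≢k ∘ cong suc) (rows≡ ∘ punchIn j))
det-equalRow₀ {suc n} M zero rows≡ =
  x≡-x⇒x≡0 (trans (det-swap₀₁ M) (cong -_ (det-cong swapped≈)))
  where
  swapped≈ : ∀ i j → M (swap₀₁ i) j ≡ M i j
  swapped≈ zero          j = sym (rows≡ j)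
  swapped≈ (suc zero)    j = rows≡ j
  swapped≈ (suc (suc i)) j = refl
det-equalRow₀ {suc n} M (suc k) rows≡ = trans (det-swap₀₁ M) (cong -_ (det-minors≡0 (M ∘ swap₀₁)
  (λ j → det-equalRows (minor (M ∘ swap₀₁) zero j) {zero} {suc k} (λ ()) (rows≡ ∘ punchIn j))))

replaceRow : ∀ {n} → Mat n → Fin n → (Fin n → ℤ) → Mat n
replaceRow M k v r with r ≟ k
... | yes _ = v
... | no _  = M r

replaceRow-≡ : ∀ {n} (M : Mat n) k v → replaceRow M k v k ≡ v
replaceRow-≡ M k v with k ≟ k
... | yes _  = refl
... | no k≢k = contradiction refl k≢k

replaceRow-≢ : ∀ {n} (M : Mat n) {k r} v → r ≢ k → replaceRow M k v r ≡ M r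
replaceRow-≢ M {k} {r} v r≢k with r ≟ k
... | yes r≡k = contradiction r≡k r≢k
... | no _    = refl

-- For i ≢ k the sum is the expansion along row k of M with row k replaced by row i.
adjugate-identity : ∀ {n} (M : Mat (suc n)) (i k : Fin (suc n)) →
  sum (λ j → M i j * cofactor M k j) ≡ δ i k * det M
adjugate-identity M i k with i ≟ k
... | yes refl = trans (sym (det-expandRow M i)) (sym (ℤ.*-identityˡ (det M)))
... | no i≢k = begin
  sum (λ j → M i j * cofactor M k j)
    ≡⟨ sum-cong-≗ (λ j → cong₂ (λ x c → x * (altSign (toℕ k ℕ.+ toℕ j) * c))
                                 (cong (_$ j) (replaceRow-≡ M k (M i)))
                                 (det-cong (λ r t → cong (_$ punchIn j t) (replaceRow-≢ M (M i) (punchInᵢ≢i k r))))) ⟨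
  sum (λ j → M′ k j * cofactor M′ k j)
    ≡⟨ det-expandRow M′ k ⟨
  det M′
    ≡⟨ det-equalRows M′ i≢k (λ j → cong (_$ j) (trans (replaceRow-≢ M (M i) i≢k) (sym (replaceRow-≡ M k (M i))))) ⟩
  0ℤ
    ≡⟨ ℤ.*-zeroˡ (det M) ⟨
  0ℤ * det M ∎
  where
  open ≡-Reasoning
  M′ = replaceRow M k (M i)

-- Integer polynomials

-- Coefficient lists, constant term first.
Poly : Set
Poly = List ℤ

eval : Poly → ℤ → ℤ
eval []      x = 0ℤ
eval (c ∷ p) x = c + x * eval p x

coeff : Poly → ℕ → ℤ
coeff []      l       = 0ℤ
coeff (c ∷ p) zero    = c
coeff (c ∷ p) (suc l) = coeff p l

infixl 6 _+ᴾ_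
infixl 7 _*ᴾ_ _•ᴾ_

_+ᴾ_ : Poly → Poly → Poly
[]      +ᴾ q       = q
(a ∷ p) +ᴾ []      = a ∷ p
(a ∷ p) +ᴾ (b ∷ q) = (a + b) ∷ (p +ᴾ q)

_•ᴾ_ : ℤ → Poly → Poly
c •ᴾ []      = []
c •ᴾ (a ∷ p) = c * a ∷ c •ᴾ p

-- Multiplication by x, so that coeff (shift p) l is the coefficient of x^(l − 1) in p (0 for l = 0).
shift : Poly → Poly
shift p = 0ℤ ∷ p

_*ᴾ_ : Poly → Poly → Poly
[]      *ᴾ q = []
(c ∷ p) *ᴾ q = c •ᴾ q +ᴾ shift (p *ᴾ q)

constᴾ : ℤ → Poly
constᴾ c = c ∷ []

linear : ℤ → Poly
linear c = c ∷ 1ℤ ∷ []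

_^ᴾ_ : Poly → ℕ → Poly
p ^ᴾ zero  = constᴾ 1ℤ
p ^ᴾ suc k = p *ᴾ p ^ᴾ k

sumᴾ : ∀ {n} → (Fin n → Poly) → Poly
sumᴾ {zero}  f = []
sumᴾ {suc n} f = f zero +ᴾ sumᴾ (f ∘ suc)

eval-+ : ∀ p q x → eval (p +ᴾ q) x ≡ eval p x + eval q x
eval-+ []      q       x = sym (ℤ.+-identityˡ _)
eval-+ (a ∷ p) []      x = sym (ℤ.+-identityʳ _)
eval-+ (a ∷ p) (b ∷ q) x = trans (cong (λ e → a + b + x * e) (eval-+ p q x)) (regroup a b x (eval p x) (eval q x))
  where
  regroup : ∀ a b x u v → a + b + x * (u + v) ≡ a + x * u + (b + x * v)
  regroup = solve-∀

eval-• : ∀ c p x → eval (c •ᴾ p) x ≡ c * eval p x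
eval-• c []      x = sym (ℤ.*-zeroʳ c)
eval-• c (a ∷ p) x = trans (cong (λ e → c * a + x * e) (eval-• c p x)) (regroup c a x (eval p x))
  where
  regroup : ∀ c a x u → c * a + x * (c * u) ≡ c * (a + x * u)
  regroup = solve-∀

eval-* : ∀ p q x → eval (p *ᴾ q) x ≡ eval p x * eval q x
eval-* []      q x = sym (ℤ.*-zeroˡ (eval q x))
eval-* (c ∷ p) q x = begin
  eval (c •ᴾ q +ᴾ shift (p *ᴾ q)) x             ≡⟨ eval-+ (c •ᴾ q) (shift (p *ᴾ q)) x ⟩
  eval (c •ᴾ q) x + (0ℤ + x * eval (p *ᴾ q) x)  ≡⟨ cong₂ (λ u v → u + (0ℤ + x * v)) (eval-• c q x) (eval-* p q x) ⟩
  c * eval q x + (0ℤ + x * (eval p x * eval q x)) ≡⟨ regroup c x (eval p x) (eval q x) ⟩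
  (c + x * eval p x) * eval q x                 ∎
  where
  open ≡-Reasoning
  regroup : ∀ c x u v → c * v + (0ℤ + x * (u * v)) ≡ (c + x * u) * v
  regroup = solve-∀

eval-const : ∀ c x → eval (constᴾ c) x ≡ c
eval-const c x = trans (cong (_+_ c) (ℤ.*-zeroʳ x)) (ℤ.+-identityʳ c)

eval-linear : ∀ c x → eval (linear c) x ≡ x + c
eval-linear c x = trans (cong (λ e → c + x * e) (eval-const 1ℤ x)) (trans (cong (_+_ c) (ℤ.*-identityʳ x)) (ℤ.+-comm c x))

eval-^ : ∀ p k x → eval (p ^ᴾ k) x ≡ eval p x ^ k
eval-^ p zero    x = eval-const 1ℤ x
eval-^ p (suc k) x = trans (eval-* p (p ^ᴾ k) x) (cong (eval p x *_) (eval-^ p k x))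

eval-sum : ∀ {n} (f : Fin n → Poly) x → eval (sumᴾ f) x ≡ sum (λ i → eval (f i) x)
eval-sum {zero}  f x = refl
eval-sum {suc n} f x = trans (eval-+ (f zero) (sumᴾ (f ∘ suc)) x) (cong (_+_ (eval (f zero) x)) (eval-sum (f ∘ suc) x))

coeff-+ : ∀ p q l → coeff (p +ᴾ q) l ≡ coeff p l + coeff q l
coeff-+ []      q       l       = sym (ℤ.+-identityˡ _)
coeff-+ (a ∷ p) []      l       = sym (ℤ.+-identityʳ _)
coeff-+ (a ∷ p) (b ∷ q) zero    = refl
coeff-+ (a ∷ p) (b ∷ q) (suc l) = coeff-+ p q l

coeff-• : ∀ c p l → coeff (c •ᴾ p) l ≡ c * coeff p l
coeff-• c []      l       = sym (ℤ.*-zeroʳ c)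
coeff-• c (a ∷ p) zero    = refl
coeff-• c (a ∷ p) (suc l) = coeff-• c p l

coeff-∷* : ∀ c p q l → coeff ((c ∷ p) *ᴾ q) l ≡ c * coeff q l + coeff (shift (p *ᴾ q)) l
coeff-∷* c p q l = trans (coeff-+ (c •ᴾ q) (shift (p *ᴾ q)) l) (cong (_+ coeff (shift (p *ᴾ q)) l) (coeff-• c q l))

coeff-const* : ∀ c q l → coeff (constᴾ c *ᴾ q) l ≡ c * coeff q l
coeff-const* c q l = trans (coeff-∷* c [] q l) (trans (cong (_+_ (c * coeff q l)) (shift[]≡0 l)) (ℤ.+-identityʳ _))
  where
  shift[]≡0 : ∀ l → coeff (shift []) l ≡ 0ℤ
  shift[]≡0 zero    = refl
  shift[]≡0 (suc l) = refl

coeff-shift-cong : ∀ p q → (∀ l → coeff p l ≡ coeff q l) → ∀ l → coeff (shift p) l ≡ coeff (shift q) l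
coeff-shift-cong p q p≈q zero    = refl
coeff-shift-cong p q p≈q (suc l) = p≈q l

coeff-linear* : ∀ c q l → coeff (linear c *ᴾ q) l ≡ c * coeff q l + coeff (shift q) l
coeff-linear* c q l = trans (coeff-∷* c (1ℤ ∷ []) q l)
  (cong (_+_ (c * coeff q l)) (coeff-shift-cong (constᴾ 1ℤ *ᴾ q) q (λ l → trans (coeff-const* 1ℤ q l) (ℤ.*-identityˡ _)) l))

coeff-sum : ∀ {n} (f : Fin n → Poly) l → coeff (sumᴾ f) l ≡ sum (λ i → coeff (f i) l)
coeff-sum {zero}  f l = refl
coeff-sum {suc n} f l = trans (coeff-+ (f zero) (sumᴾ (f ∘ suc)) l) (cong (_+_ (coeff (f zero) l)) (coeff-sum (f ∘ suc) l))

private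
  -- Evaluating at x = 1 + ∣c∣ makes the constant term c a multiple of a number exceeding ∣c∣.
  constTerm≡0 : ∀ c e → c + + suc ∣ c ∣ * e ≡ 0ℤ → c ≡ 0ℤ
  constTerm≡0 c e c+xe≡0 = ℤ.∣i∣≡0⇒i≡0 (∣c∣≡0 ∣ e ∣ ∣c∣≡x∣e∣)
    where
    x = suc ∣ c ∣
    cancel : ∀ c y → c ≡ c + y - y
    cancel = solve-∀
    c≡-xe : c ≡ - (+ x * e)
    c≡-xe = trans (cancel c (+ x * e)) (trans (cong (_- (+ x * e)) c+xe≡0) (ℤ.+-identityˡ _))
    ∣c∣≡x∣e∣ : ∣ c ∣ ≡ x ℕ.* ∣ e ∣
    ∣c∣≡x∣e∣ = trans (cong ∣_∣ c≡-xe) (trans (ℤ.∣-i∣≡∣i∣ (+ x * e)) (ℤ.abs-* (+ x) e))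
    ∣c∣≡0 : ∀ k → ∣ c ∣ ≡ x ℕ.* k → ∣ c ∣ ≡ 0
    ∣c∣≡0 zero    ∣c∣≡xk = trans ∣c∣≡xk (ℕ.*-zeroʳ x)
    ∣c∣≡0 (suc k) ∣c∣≡xk = contradiction (subst (x ℕ.≤_) (sym ∣c∣≡xk) (ℕ.m≤m*n x (suc k))) (ℕ.<-irrefl refl)

vanishing⇒coeff≡0 : ∀ p → (∀ x → x ≢ 0ℤ → eval p x ≡ 0ℤ) → ∀ l → coeff p l ≡ 0ℤ
vanishing⇒coeff≡0 []      p≡0 l       = refl
vanishing⇒coeff≡0 (c ∷ p) p≡0 zero    = constTerm≡0 c (eval p (+ suc ∣ c ∣)) (p≡0 (+ suc ∣ c ∣) (λ ()))
vanishing⇒coeff≡0 (c ∷ p) p≡0 (suc l) = vanishing⇒coeff≡0 p tail≡0 l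
  where
  c≡0 = vanishing⇒coeff≡0 (c ∷ p) p≡0 zero
  tail≡0 : ∀ x → x ≢ 0ℤ → eval p x ≡ 0ℤ
  tail≡0 x x≢0 with ℤ.i*j≡0⇒i≡0∨j≡0 x (trans (sym (ℤ.+-identityˡ _)) (trans (cong (λ c → c + x * eval p x) (sym c≡0)) (p≡0 x x≢0)))
  ... | inj₁ x≡0 = contradiction x≡0 x≢0
  ... | inj₂ e≡0 = e≡0

coeff-unique : ∀ p q → (∀ x → eval p x ≡ eval q x) → ∀ l → coeff p l ≡ coeff q l
coeff-unique p q p≗q l = begin
  coeff p l                                ≡⟨ regroup (coeff p l) (coeff q l) ⟩
  coeff p l + - 1ℤ * coeff q l + coeff q l ≡⟨ cong (_+ coeff q l) diff≡0 ⟩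
  0ℤ + coeff q l                           ≡⟨ ℤ.+-identityˡ (coeff q l) ⟩
  coeff q l                                ∎
  where
  open ≡-Reasoning
  regroup : ∀ a b → a ≡ a + - 1ℤ * b + b
  regroup = solve-∀
  cancel : ∀ u → u + - 1ℤ * u ≡ 0ℤ
  cancel = solve-∀
  diff = p +ᴾ (- 1ℤ) •ᴾ q
  diff-vanishes : ∀ x → x ≢ 0ℤ → eval diff x ≡ 0ℤ
  diff-vanishes x _ = begin
    eval diff x                         ≡⟨ eval-+ p ((- 1ℤ) •ᴾ q) x ⟩
    eval p x + eval ((- 1ℤ) •ᴾ q) x     ≡⟨ cong₂ _+_ (p≗q x) (eval-• (- 1ℤ) q x) ⟩
    eval q x + - 1ℤ * eval q x          ≡⟨ cancel (eval q x) ⟩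
    0ℤ                                  ∎
  diff≡0 : coeff p l + - 1ℤ * coeff q l ≡ 0ℤ
  diff≡0 = begin
    coeff p l + - 1ℤ * coeff q l        ≡⟨ cong (_+_ (coeff p l)) (coeff-• (- 1ℤ) q l) ⟨
    coeff p l + coeff ((- 1ℤ) •ᴾ q) l   ≡⟨ coeff-+ p ((- 1ℤ) •ᴾ q) l ⟨
    coeff diff l                        ≡⟨ vanishing⇒coeff≡0 diff diff-vanishes l ⟩
    0ℤ                                  ∎

Deg≤ : ℕ → Poly → Set
Deg≤ d p = ∀ l → d ℕ.< l → coeff p l ≡ 0ℤ

Deg≤-mono : ∀ {d e p} → d ℕ.≤ e → Deg≤ d p → Deg≤ e p
Deg≤-mono d≤e p≤d l e<l = p≤d l (ℕ.≤-<-trans d≤e e<l)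

Deg≤-const : ∀ c → Deg≤ 0 (constᴾ c)
Deg≤-const c (suc l) _ = refl

Deg≤-linear : ∀ c → Deg≤ 1 (linear c)
Deg≤-linear c (suc zero)    (s≤s ())
Deg≤-linear c (suc (suc l)) _ = refl

private
  zero*ᴾ : ∀ p q → (∀ l → coeff p l ≡ 0ℤ) → ∀ l → coeff (p *ᴾ q) l ≡ 0ℤ
  zero*ᴾ []      q p≡0 l = refl
  zero*ᴾ (c ∷ p) q p≡0 l = begin
    coeff ((c ∷ p) *ᴾ q) l                   ≡⟨ coeff-∷* c p q l ⟩
    c * coeff q l + coeff (shift (p *ᴾ q)) l ≡⟨ cong₂ _+_ (trans (cong (_* coeff q l) (p≡0 zero)) (ℤ.*-zeroˡ (coeff q l))) (shifted l) ⟩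
    0ℤ                                       ∎
    where
    open ≡-Reasoning
    shifted : ∀ l → coeff (shift (p *ᴾ q)) l ≡ 0ℤ
    shifted zero    = refl
    shifted (suc l) = zero*ᴾ p q (p≡0 ∘ suc) l

Deg≤-* : ∀ d e p q → Deg≤ d p → Deg≤ e q → Deg≤ (d ℕ.+ e) (p *ᴾ q)
Deg≤-* d e []      q p≤d q≤e l d+e<l = refl
Deg≤-* d e (c ∷ p) q p≤d q≤e l d+e<l = begin
  coeff ((c ∷ p) *ᴾ q) l                    ≡⟨ coeff-∷* c p q l ⟩
  c * coeff q l + coeff (shift (p *ᴾ q)) l  ≡⟨ cong₂ _+_ (trans (cong (c *_) (q≤e l (ℕ.≤-<-trans (ℕ.m≤n+m e d) d+e<l))) (ℤ.*-zeroʳ c))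
                                                       (shifted d l p≤d d+e<l) ⟩
  0ℤ                                        ∎
  where
  open ≡-Reasoning
  shifted : ∀ d l → Deg≤ d (c ∷ p) → d ℕ.+ e ℕ.< l → coeff (shift (p *ᴾ q)) l ≡ 0ℤ
  shifted zero    (suc l) p≤0 _           = zero*ᴾ p q (λ k → p≤0 (suc k) (s≤s z≤n)) l
  shifted (suc d) (suc l) p≤d (s≤s d+e<l) = Deg≤-* d e p q (λ k d<k → p≤d (suc k) (s≤s d<k)) q≤e l d+e<l

Deg≤-sum : ∀ {n d} (f : Fin n → Poly) → (∀ i → Deg≤ d (f i)) → Deg≤ d (sumᴾ f)
Deg≤-sum f f≤d l d<l = trans (coeff-sum f l) (sum-zero _ (λ i → f≤d i l d<l))

detᴾ : ∀ {n} → (Fin n → Fin n → Poly) → Poly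
detᴾ {zero}  M = constᴾ 1ℤ
detᴾ {suc n} M = sumᴾ λ j → constᴾ (altSign (toℕ j)) *ᴾ M zero j *ᴾ detᴾ (minor M zero j)

eval-det : ∀ {n} (M : Fin n → Fin n → Poly) x → eval (detᴾ M) x ≡ det (λ i j → eval (M i j) x)
eval-det {zero}  M x = eval-const 1ℤ x
eval-det {suc n} M x = begin
  eval (detᴾ M) x
    ≡⟨ eval-sum (λ j → constᴾ (altSign (toℕ j)) *ᴾ M zero j *ᴾ detᴾ (minor M zero j)) x ⟩
  sum (λ j → eval (constᴾ (altSign (toℕ j)) *ᴾ M zero j *ᴾ detᴾ (minor M zero j)) x)
    ≡⟨ sum-cong-≗ entry ⟩
  sum (λ j → altSign (toℕ j) * eval (M zero j) x * det (minor (λ i j → eval (M i j) x) zero j))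
    ≡⟨ det-expand₀ (λ i j → eval (M i j) x) ⟨
  det (λ i j → eval (M i j) x) ∎
  where
  open ≡-Reasoning
  entry : ∀ j → eval (constᴾ (altSign (toℕ j)) *ᴾ M zero j *ᴾ detᴾ (minor M zero j)) x
                ≡ altSign (toℕ j) * eval (M zero j) x * det (minor (λ i j → eval (M i j) x) zero j)
  entry j = begin
    eval (constᴾ (altSign (toℕ j)) *ᴾ M zero j *ᴾ detᴾ (minor M zero j)) x
      ≡⟨ eval-* (constᴾ (altSign (toℕ j)) *ᴾ M zero j) (detᴾ (minor M zero j)) x ⟩
    eval (constᴾ (altSign (toℕ j)) *ᴾ M zero j) x * eval (detᴾ (minor M zero j)) x
      ≡⟨ cong₂ _*_ (trans (eval-* (constᴾ (altSign (toℕ j))) (M zero j) x) (cong (_* eval (M zero j) x) (eval-const (altSign (toℕ j)) x)))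
                   (eval-det (minor M zero j) x) ⟩
    altSign (toℕ j) * eval (M zero j) x * det (minor (λ i j → eval (M i j) x) zero j) ∎

Deg≤-det : ∀ {n} (M : Fin n → Fin n → Poly) → (∀ i j → Deg≤ 1 (M i j)) → Deg≤ n (detᴾ M)
Deg≤-det {zero}  M M≤1 = Deg≤-const 1ℤ
Deg≤-det {suc n} M M≤1 = Deg≤-sum (λ j → signedEntry j *ᴾ minorᴾ j) (λ j →
  Deg≤-* 1 n (signedEntry j) (minorᴾ j) (Deg≤-* 0 1 (constᴾ (altSign (toℕ j))) (M zero j) (Deg≤-const (altSign (toℕ j))) (M≤1 zero j))
                                        (Deg≤-det (minor M zero j) (λ i k → M≤1 (suc i) (punchIn j k))))
  where
  signedEntry : Fin (suc n) → Poly
  signedEntry j = constᴾ (altSign (toℕ j)) *ᴾ M zero j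
  minorᴾ : Fin (suc n) → Poly
  minorᴾ j = detᴾ (minor M zero j)

-- q is monic of degree d and its next two coefficients are those of a product of linear
-- factors x + cᵢ with Σ cᵢ = s and Σ cᵢ² = V (so that they are s and (s² − V)/2).
record MonicTop (q : Poly) (d : ℕ) (s V : ℤ) : Set where
  field
    deg≤  : Deg≤ d q
    lead  : coeff q d ≡ 1ℤ
    next₁ : coeff (shift q) d ≡ s
    next₂ : + 2 * coeff (shift (shift q)) d ≡ s * s - V

MonicTop-unique : ∀ {q d s s′ V V′} → MonicTop q d s V → MonicTop q d s′ V′ → s ≡ s′ × V ≡ V′
MonicTop-unique {s = s} {s′} {V} {V′} top top′ = s≡s′ , V≡V′
  where
  open ≡-Reasoning
  open MonicTop
  s≡s′ : s ≡ s′
  s≡s′ = trans (sym (next₁ top)) (next₁ top′)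
  recover : ∀ s V → V ≡ s * s - (s * s - V)
  recover = solve-∀
  V≡V′ : V ≡ V′
  V≡V′ = begin
    V                     ≡⟨ recover s V ⟩
    s * s - (s * s - V)   ≡⟨ cong (λ t → s * s - t) (trans (sym (next₂ top)) (trans (next₂ top′) (cong (λ x → x * x - V′) (sym s≡s′)))) ⟩
    s * s - (s * s - V′)  ≡⟨ recover s V′ ⟨
    V′                    ∎

MonicTop-const1 : MonicTop (constᴾ 1ℤ) 0 0ℤ 0ℤ
MonicTop-const1 = record { deg≤ = Deg≤-const 1ℤ ; lead = refl ; next₁ = refl ; next₂ = refl }

MonicTop-linear* : ∀ {q d s V} c → MonicTop q d s V → MonicTop (linear c *ᴾ q) (suc d) (s + c) (V + c * c)
MonicTop-linear* {q} {d} {s} {V} c top = record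
  { deg≤  = Deg≤-* 1 d (linear c) q (Deg≤-linear c) deg≤
  ; lead  = begin
      coeff (linear c *ᴾ q) (suc d)            ≡⟨ coeff-linear* c q (suc d) ⟩
      c * coeff q (suc d) + coeff q d          ≡⟨ cong₂ _+_ (trans (cong (c *_) (deg≤ (suc d) (ℕ.n<1+n d))) (ℤ.*-zeroʳ c)) lead ⟩
      1ℤ                                       ∎
  ; next₁ = begin
      coeff (linear c *ᴾ q) d                  ≡⟨ coeff-linear* c q d ⟩
      c * coeff q d + coeff (shift q) d        ≡⟨ cong₂ _+_ (trans (cong (c *_) lead) (ℤ.*-identityʳ c)) next₁ ⟩
      c + s                                    ≡⟨ ℤ.+-comm c s ⟩
      s + c                                    ∎
  ; next₂ = begin
      + 2 * coeff (shift (linear c *ᴾ q)) d                        ≡⟨ cong (+ 2 *_) (coeff-shift-linear* d) ⟩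
      + 2 * (c * coeff (shift q) d + coeff (shift (shift q)) d)   ≡⟨ ℤ.*-distribˡ-+ (+ 2) (c * coeff (shift q) d) (coeff (shift (shift q)) d) ⟩
      + 2 * (c * coeff (shift q) d) + + 2 * coeff (shift (shift q)) d ≡⟨ cong₂ _+_ (cong (λ t → + 2 * (c * t)) next₁) next₂ ⟩
      + 2 * (c * s) + (s * s - V)                                  ≡⟨ expand c s V ⟩
      (s + c) * (s + c) - (V + c * c)                              ∎
  }
  where
  open ≡-Reasoning
  open MonicTop top
  expand : ∀ c s V → + 2 * (c * s) + (s * s - V) ≡ (s + c) * (s + c) - (V + c * c)
  expand = solve-∀
  coeff-shift-linear* : ∀ l → coeff (shift (linear c *ᴾ q)) l ≡ c * coeff (shift q) l + coeff (shift (shift q)) l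
  coeff-shift-linear* zero    = sym (trans (cong (_+ 0ℤ) (ℤ.*-zeroʳ c)) refl)
  coeff-shift-linear* (suc l) = coeff-linear* c q l

linear^* : ℤ → ℕ → Poly → Poly
linear^* c zero    q = q
linear^* c (suc k) q = linear c *ᴾ linear^* c k q

eval-linear^* : ∀ c k q x → eval (linear^* c k q) x ≡ (x + c) ^ k * eval q x
eval-linear^* c zero    q x = sym (ℤ.*-identityˡ _)
eval-linear^* c (suc k) q x = begin
  eval (linear c *ᴾ linear^* c k q) x         ≡⟨ eval-* (linear c) (linear^* c k q) x ⟩
  eval (linear c) x * eval (linear^* c k q) x ≡⟨ cong₂ _*_ (eval-linear c x) (eval-linear^* c k q x) ⟩
  (x + c) * ((x + c) ^ k * eval q x)          ≡⟨ ℤ.*-assoc (x + c) _ _ ⟨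
  (x + c) ^ suc k * eval q x                  ∎
  where open ≡-Reasoning

MonicTop-linear^* : ∀ {q d s V} c k → MonicTop q d s V → MonicTop (linear^* c k q) (k ℕ.+ d) (s + + k * c) (V + + k * (c * c))
MonicTop-linear^* {q} {d} {s} {V} c zero    top = subst₂ (MonicTop q d) (sym (ℤ.+-identityʳ s)) (sym (ℤ.+-identityʳ V)) top
MonicTop-linear^* {q} {d} {s} {V} c (suc k) top = subst₂ (MonicTop (linear^* c (suc k) q) (suc k ℕ.+ d))
  (shift-sum s (+ k) c) (shift-sum V (+ k) (c * c)) (MonicTop-linear* c (MonicTop-linear^* c k top))
  where
  shift-sum : ∀ s k c → s + k * c + c ≡ s + (1ℤ + k) * c
  shift-sum = solve-∀

coeff≢0⇒<length : ∀ p l → coeff p l ≢ 0ℤ → l ℕ.< length p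
coeff≢0⇒<length []      l       c≢0 = contradiction refl c≢0
coeff≢0⇒<length (c ∷ p) zero    c≢0 = s≤s z≤n
coeff≢0⇒<length (c ∷ p) (suc l) c≢0 = s≤s (coeff≢0⇒<length p l c≢0)

MonicTop-resp : ∀ {p q d s V} → (∀ l → coeff p l ≡ coeff q l) → MonicTop p d s V → MonicTop q d s V
MonicTop-resp {p} {q} {d} p≈q top = record
  { deg≤  = λ l d<l → trans (sym (p≈q l)) (deg≤ l d<l)
  ; lead  = trans (sym (p≈q d)) lead
  ; next₁ = trans (sym (coeff-shift-cong p q p≈q d)) next₁
  ; next₂ = trans (cong (+ 2 *_) (sym (coeff-shift-cong (shift p) (shift q) (coeff-shift-cong p q p≈q) d))) next₂
  }
  where open MonicTop top

-- Matrices

infix  4 _≈ᴹ_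
infixl 6 _+ᴹ_ _-ᴹ_
infixl 7 _*ᴹ_ _•ᴹ_

_≈ᴹ_ : ∀ {n} → Mat n → Mat n → Set
M ≈ᴹ N = ∀ i j → M i j ≡ N i j

≈ᴹ-refl : ∀ {n} {M : Mat n} → M ≈ᴹ M
≈ᴹ-refl i j = refl

≈ᴹ-sym : ∀ {n} {M N : Mat n} → M ≈ᴹ N → N ≈ᴹ M
≈ᴹ-sym M≈N i j = sym (M≈N i j)

≈ᴹ-trans : ∀ {n} {M N P : Mat n} → M ≈ᴹ N → N ≈ᴹ P → M ≈ᴹ P
≈ᴹ-trans M≈N N≈P i j = trans (M≈N i j) (N≈P i j)

≈ᴹ-setoid : ℕ → Setoid _ _
≈ᴹ-setoid n = record
  { Carrier       = Mat n
  ; _≈_           = _≈ᴹ_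
  ; isEquivalence = record { refl = ≈ᴹ-refl ; sym = ≈ᴹ-sym ; trans = ≈ᴹ-trans }
  }

module ≈ᴹ-Reasoning {n} = Relation.Binary.Reasoning.Setoid (≈ᴹ-setoid n)

0ᴹ : ∀ {n} → Mat n
0ᴹ i j = 0ℤ

1ᴹ : ∀ {n} → Mat n
1ᴹ = δ

_+ᴹ_ : ∀ {n} → Mat n → Mat n → Mat n
(M +ᴹ N) i j = M i j + N i j

_-ᴹ_ : ∀ {n} → Mat n → Mat n → Mat n
(M -ᴹ N) i j = M i j - N i j

_•ᴹ_ : ∀ {n} → ℤ → Mat n → Mat n
(c •ᴹ M) i j = c * M i j

_*ᴹ_ : ∀ {n} → Mat n → Mat n → Mat n
(M *ᴹ N) i k = sum (λ j → M i j * N j k)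

Symmetric : ∀ {n} → Mat n → Set
Symmetric M = ∀ i j → M i j ≡ M j i

module _ {n : ℕ} where
  open ≡-Reasoning

  *ᴹ-cong : {M M′ N N′ : Mat n} → M ≈ᴹ M′ → N ≈ᴹ N′ → M *ᴹ N ≈ᴹ M′ *ᴹ N′
  *ᴹ-cong M≈ N≈ i k = sum-cong-≗ (λ j → cong₂ _*_ (M≈ i j) (N≈ j k))

  +ᴹ-cong : {M M′ N N′ : Mat n} → M ≈ᴹ M′ → N ≈ᴹ N′ → M +ᴹ N ≈ᴹ M′ +ᴹ N′
  +ᴹ-cong M≈ N≈ i k = cong₂ _+_ (M≈ i k) (N≈ i k)

  *ᴹ-congˡ : (M : Mat n) {N N′ : Mat n} → N ≈ᴹ N′ → M *ᴹ N ≈ᴹ M *ᴹ N′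
  *ᴹ-congˡ M = *ᴹ-cong (≈ᴹ-refl {M = M})

  *ᴹ-congʳ : {M M′ : Mat n} (N : Mat n) → M ≈ᴹ M′ → M *ᴹ N ≈ᴹ M′ *ᴹ N
  *ᴹ-congʳ N M≈ = *ᴹ-cong M≈ (≈ᴹ-refl {M = N})

  +ᴹ-congˡ : (M : Mat n) {N N′ : Mat n} → N ≈ᴹ N′ → M +ᴹ N ≈ᴹ M +ᴹ N′
  +ᴹ-congˡ M = +ᴹ-cong (≈ᴹ-refl {M = M})

  •ᴹ-congˡ : ∀ c {M M′ : Mat n} → M ≈ᴹ M′ → c •ᴹ M ≈ᴹ c •ᴹ M′
  •ᴹ-congˡ c M≈ i k = cong (c *_) (M≈ i k)

  *ᴹ-assoc : (M N P : Mat n) → (M *ᴹ N) *ᴹ P ≈ᴹ M *ᴹ (N *ᴹ P)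
  *ᴹ-assoc M N P i l = begin
    sum (λ k → sum (λ j → M i j * N j k) * P k l)   ≡⟨ sum-cong-≗ (λ k → *-distribʳ-sum (P k l) (λ j → M i j * N j k)) ⟩
    sum (λ k → sum (λ j → M i j * N j k * P k l))   ≡⟨ ∑-comm (λ k j → M i j * N j k * P k l) ⟩
    sum (λ j → sum (λ k → M i j * N j k * P k l))   ≡⟨ sum-cong-≗ (λ j → trans (sum-cong-≗ (λ k → ℤ.*-assoc (M i j) (N j k) (P k l)))
                                                                           (sym (*-distribˡ-sum (M i j) (λ k → N j k * P k l)))) ⟩
    sum (λ j → M i j * sum (λ k → N j k * P k l))   ∎

  *ᴹ-distribˡ-+ᴹ : (M N P : Mat n) → M *ᴹ (N +ᴹ P) ≈ᴹ M *ᴹ N +ᴹ M *ᴹ P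
  *ᴹ-distribˡ-+ᴹ M N P i k = trans (sum-cong-≗ (λ j → ℤ.*-distribˡ-+ (M i j) (N j k) (P j k))) (∑-distrib-+ (λ j → M i j * N j k) (λ j → M i j * P j k))

  *ᴹ-distribʳ-+ᴹ : (M N P : Mat n) → (N +ᴹ P) *ᴹ M ≈ᴹ N *ᴹ M +ᴹ P *ᴹ M
  *ᴹ-distribʳ-+ᴹ M N P i k = trans (sum-cong-≗ (λ j → ℤ.*-distribʳ-+ (M j k) (N i j) (P i j))) (∑-distrib-+ (λ j → N i j * M j k) (λ j → P i j * M j k))

  •ᴹ-*ᴹ : ∀ c (M N : Mat n) → (c •ᴹ M) *ᴹ N ≈ᴹ c •ᴹ (M *ᴹ N)
  •ᴹ-*ᴹ c M N i k = trans (sum-cong-≗ (λ j → ℤ.*-assoc c (M i j) (N j k))) (sym (*-distribˡ-sum c (λ j → M i j * N j k)))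

  *ᴹ-•ᴹ : ∀ c (M N : Mat n) → M *ᴹ (c •ᴹ N) ≈ᴹ c •ᴹ (M *ᴹ N)
  *ᴹ-•ᴹ c M N i k = trans (sum-cong-≗ (λ j → swap (M i j) c (N j k))) (sym (*-distribˡ-sum c (λ j → M i j * N j k)))
    where
    swap : ∀ x c y → x * (c * y) ≡ c * (x * y)
    swap = solve-∀

  *ᴹ-identityˡ : (M : Mat n) → 1ᴹ *ᴹ M ≈ᴹ M
  *ᴹ-identityˡ M i k = sum-δˡ i (λ j → M j k)

  *ᴹ-identityʳ : (M : Mat n) → M *ᴹ 1ᴹ ≈ᴹ M
  *ᴹ-identityʳ M i k = sum-δʳ k (M i)

  *ᴹ-zeroˡ : (M : Mat n) → 0ᴹ *ᴹ M ≈ᴹ 0ᴹ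
  *ᴹ-zeroˡ M i k = sum-zero (λ j → 0ℤ * M j k) (λ j → ℤ.*-zeroˡ (M j k))

  *ᴹ-zeroʳ : (M : Mat n) → M *ᴹ 0ᴹ ≈ᴹ 0ᴹ
  *ᴹ-zeroʳ M i k = sum-zero (λ j → M i j * 0ℤ) (λ j → ℤ.*-zeroʳ (M i j))

  0•1ᴹ+ᴹ : (M : Mat n) → 0ℤ •ᴹ 1ᴹ +ᴹ M ≈ᴹ M
  0•1ᴹ+ᴹ M i j = trans (cong (_+ M i j) (ℤ.*-zeroˡ (δ i j))) (ℤ.+-identityˡ (M i j))

  symmetric-square≡0 : (T : Mat n) → Symmetric T → T *ᴹ T ≈ᴹ 0ᴹ → T ≈ᴹ 0ᴹ
  symmetric-square≡0 T T-sym T²≡0 i = sum-squares≡0 (T i) (trans (sum-cong-≗ (λ k → cong (T i k *_) (T-sym i k))) (T²≡0 i i))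

module _ {n : ℕ} (A : Mat n) where

  evalᴹ : Poly → Mat n
  evalᴹ []      = 0ᴹ
  evalᴹ (c ∷ p) = c •ᴹ 1ᴹ +ᴹ A *ᴹ evalᴹ p

  evalᴹ-+ᴾ : ∀ p q → evalᴹ (p +ᴾ q) ≈ᴹ evalᴹ p +ᴹ evalᴹ q
  evalᴹ-+ᴾ []      q       i j = sym (ℤ.+-identityˡ _)
  evalᴹ-+ᴾ (a ∷ p) []      i j = sym (ℤ.+-identityʳ _)
  evalᴹ-+ᴾ (a ∷ p) (b ∷ q) i j = trans
    (cong₂ _+_ (ℤ.*-distribʳ-+ (δ i j) a b) (trans (*ᴹ-congˡ A (evalᴹ-+ᴾ p q) i j) (*ᴹ-distribˡ-+ᴹ A (evalᴹ p) (evalᴹ q) i j)))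
    (regroup (a * δ i j) (b * δ i j) ((A *ᴹ evalᴹ p) i j) ((A *ᴹ evalᴹ q) i j))
    where
    regroup : ∀ x y u v → x + y + (u + v) ≡ x + u + (y + v)
    regroup = solve-∀

  evalᴹ-•ᴾ : ∀ c p → evalᴹ (c •ᴾ p) ≈ᴹ c •ᴹ evalᴹ p
  evalᴹ-•ᴾ c []      i j = sym (ℤ.*-zeroʳ c)
  evalᴹ-•ᴾ c (a ∷ p) i j = trans
    (cong (_+_ (c * a * δ i j)) (trans (*ᴹ-congˡ A (evalᴹ-•ᴾ c p) i j) (*ᴹ-•ᴹ c A (evalᴹ p) i j)))
    (regroup c a (δ i j) ((A *ᴹ evalᴹ p) i j))
    where
    regroup : ∀ c a d u → c * a * d + c * u ≡ c * (a * d + u)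
    regroup = solve-∀

  evalᴹ-*ᴾ : ∀ p q → evalᴹ (p *ᴾ q) ≈ᴹ evalᴹ p *ᴹ evalᴹ q
  evalᴹ-*ᴾ []      q = ≈ᴹ-sym (*ᴹ-zeroˡ (evalᴹ q))
  evalᴹ-*ᴾ (c ∷ p) q = begin
    evalᴹ (c •ᴾ q +ᴾ shift (p *ᴾ q))                        ≈⟨ evalᴹ-+ᴾ (c •ᴾ q) (shift (p *ᴾ q)) ⟩
    evalᴹ (c •ᴾ q) +ᴹ (0ℤ •ᴹ 1ᴹ +ᴹ A *ᴹ evalᴹ (p *ᴾ q))     ≈⟨ +ᴹ-cong (evalᴹ-•ᴾ c q) (0•1ᴹ+ᴹ (A *ᴹ evalᴹ (p *ᴾ q))) ⟩
    c •ᴹ evalᴹ q +ᴹ A *ᴹ evalᴹ (p *ᴾ q)                     ≈⟨ +ᴹ-congˡ (c •ᴹ evalᴹ q) (*ᴹ-congˡ A (evalᴹ-*ᴾ p q)) ⟩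
    c •ᴹ evalᴹ q +ᴹ A *ᴹ (evalᴹ p *ᴹ evalᴹ q)               ≈⟨ +ᴹ-cong (≈ᴹ-sym (≈ᴹ-trans (•ᴹ-*ᴹ c 1ᴹ (evalᴹ q)) (•ᴹ-congˡ c (*ᴹ-identityˡ (evalᴹ q)))))
                                                                       (≈ᴹ-sym (*ᴹ-assoc A (evalᴹ p) (evalᴹ q))) ⟩
    (c •ᴹ 1ᴹ) *ᴹ evalᴹ q +ᴹ (A *ᴹ evalᴹ p) *ᴹ evalᴹ q       ≈⟨ ≈ᴹ-sym (*ᴹ-distribʳ-+ᴹ (evalᴹ q) (c •ᴹ 1ᴹ) (A *ᴹ evalᴹ p)) ⟩
    (c •ᴹ 1ᴹ +ᴹ A *ᴹ evalᴹ p) *ᴹ evalᴹ q                    ∎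
    where
    open ≈ᴹ-Reasoning

  evalᴹ-const1 : evalᴹ (constᴾ 1ℤ) ≈ᴹ 1ᴹ
  evalᴹ-const1 i j = trans (cong (_+_ (1ℤ * δ i j)) (*ᴹ-zeroʳ A i j)) (trans (ℤ.+-identityʳ _) (ℤ.*-identityˡ (δ i j)))

  private
    evalᴹ-vanishing : ∀ p → (∀ l → coeff p l ≡ 0ℤ) → evalᴹ p ≈ᴹ 0ᴹ
    evalᴹ-vanishing []      p≡0 = ≈ᴹ-refl
    evalᴹ-vanishing (c ∷ p) p≡0 i j = cong₂ _+_ (trans (cong (_* δ i j) (p≡0 zero)) (ℤ.*-zeroˡ (δ i j)))
                                                (trans (*ᴹ-congˡ A (evalᴹ-vanishing p (p≡0 ∘ suc)) i j) (*ᴹ-zeroʳ A i j))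

  evalᴹ-coeff : ∀ p q → (∀ l → coeff p l ≡ coeff q l) → evalᴹ p ≈ᴹ evalᴹ q
  evalᴹ-coeff []      q       p≈q = ≈ᴹ-sym (evalᴹ-vanishing q (sym ∘ p≈q))
  evalᴹ-coeff (c ∷ p) []      p≈q = evalᴹ-vanishing (c ∷ p) p≈q
  evalᴹ-coeff (c ∷ p) (b ∷ q) p≈q i j = cong₂ _+_ (cong (_* δ i j) (p≈q zero)) (*ᴹ-congˡ A (evalᴹ-coeff p q (p≈q ∘ suc)) i j)

  evalᴹ-resp-eval : ∀ p q → (∀ x → eval p x ≡ eval q x) → evalᴹ p ≈ᴹ evalᴹ q
  evalᴹ-resp-eval p q p≗q = evalᴹ-coeff p q (coeff-unique p q p≗q)

  *ᴹ-evalᴹ-comm : ∀ p → A *ᴹ evalᴹ p ≈ᴹ evalᴹ p *ᴹ A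
  *ᴹ-evalᴹ-comm []      = ≈ᴹ-trans (*ᴹ-zeroʳ A) (≈ᴹ-sym (*ᴹ-zeroˡ A))
  *ᴹ-evalᴹ-comm (c ∷ p) = begin
    A *ᴹ (c •ᴹ 1ᴹ +ᴹ A *ᴹ evalᴹ p)          ≈⟨ *ᴹ-distribˡ-+ᴹ A (c •ᴹ 1ᴹ) (A *ᴹ evalᴹ p) ⟩
    A *ᴹ (c •ᴹ 1ᴹ) +ᴹ A *ᴹ (A *ᴹ evalᴹ p)   ≈⟨ +ᴹ-cong scalar-comm (*ᴹ-congˡ A (*ᴹ-evalᴹ-comm p)) ⟩
    (c •ᴹ 1ᴹ) *ᴹ A +ᴹ A *ᴹ (evalᴹ p *ᴹ A)   ≈⟨ +ᴹ-congˡ ((c •ᴹ 1ᴹ) *ᴹ A) (≈ᴹ-sym (*ᴹ-assoc A (evalᴹ p) A)) ⟩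
    (c •ᴹ 1ᴹ) *ᴹ A +ᴹ (A *ᴹ evalᴹ p) *ᴹ A   ≈⟨ ≈ᴹ-sym (*ᴹ-distribʳ-+ᴹ A (c •ᴹ 1ᴹ) (A *ᴹ evalᴹ p)) ⟩
    (c •ᴹ 1ᴹ +ᴹ A *ᴹ evalᴹ p) *ᴹ A          ∎
    where
    open ≈ᴹ-Reasoning
    scalar-comm : A *ᴹ (c •ᴹ 1ᴹ) ≈ᴹ (c •ᴹ 1ᴹ) *ᴹ A
    scalar-comm = begin
      A *ᴹ (c •ᴹ 1ᴹ)   ≈⟨ *ᴹ-•ᴹ c A 1ᴹ ⟩
      c •ᴹ (A *ᴹ 1ᴹ)   ≈⟨ •ᴹ-congˡ c (≈ᴹ-trans (*ᴹ-identityʳ A) (≈ᴹ-sym (*ᴹ-identityˡ A))) ⟩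
      c •ᴹ (1ᴹ *ᴹ A)   ≈⟨ ≈ᴹ-sym (•ᴹ-*ᴹ c 1ᴹ A) ⟩
      (c •ᴹ 1ᴹ) *ᴹ A   ∎

  evalᴹ-sym : Symmetric A → ∀ p → Symmetric (evalᴹ p)
  evalᴹ-sym A-sym []      i j = refl
  evalᴹ-sym A-sym (c ∷ p) i j = cong₂ _+_ (cong (c *_) (δ-sym i j)) (begin
    sum (λ k → A i k * evalᴹ p k j)    ≡⟨ sum-cong-≗ (λ k → trans (cong₂ _*_ (A-sym i k) (evalᴹ-sym A-sym p k j)) (ℤ.*-comm (A k i) (evalᴹ p j k))) ⟩
    sum (λ k → evalᴹ p j k * A k i)    ≡⟨ *ᴹ-evalᴹ-comm p j i ⟨
    (A *ᴹ evalᴹ p) j i                 ∎)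
    where open ≡-Reasoning

  evalᴹ-nilpotent : Symmetric A → ∀ r m → evalᴹ (r ^ᴾ suc m) ≈ᴹ 0ᴹ → evalᴹ r ≈ᴹ 0ᴹ
  evalᴹ-nilpotent A-sym r zero    r¹≈0 = begin
    evalᴹ r                      ≈⟨ ≈ᴹ-sym (*ᴹ-identityʳ (evalᴹ r)) ⟩
    evalᴹ r *ᴹ 1ᴹ                ≈⟨ *ᴹ-congˡ (evalᴹ r) (≈ᴹ-sym evalᴹ-const1) ⟩
    evalᴹ r *ᴹ evalᴹ (constᴾ 1ℤ) ≈⟨ ≈ᴹ-sym (evalᴹ-*ᴾ r (constᴾ 1ℤ)) ⟩
    evalᴹ (r ^ᴾ 1)               ≈⟨ r¹≈0 ⟩
    0ᴹ                           ∎
    where open ≈ᴹ-Reasoning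
  evalᴹ-nilpotent A-sym r (suc m) rᵐ⁺²≈0 =
    evalᴹ-nilpotent A-sym r m (symmetric-square≡0 T (evalᴹ-sym A-sym (r ^ᴾ suc m)) T²≈0)
    where
    T = evalᴹ (r ^ᴾ suc m)
    -- T² = r^(m+2) r^m, and r^(m+2) vanishes at A.
    split : ∀ x → eval (r ^ᴾ suc m *ᴾ r ^ᴾ suc m) x ≡ eval (r ^ᴾ suc (suc m) *ᴾ r ^ᴾ m) x
    split x = begin
      eval (r ^ᴾ suc m *ᴾ r ^ᴾ suc m) x                  ≡⟨ eval-* (r ^ᴾ suc m) (r ^ᴾ suc m) x ⟩
      eval (r ^ᴾ suc m) x * eval (r ^ᴾ suc m) x          ≡⟨ cong₂ _*_ (eval-^ r (suc m) x) (eval-^ r (suc m) x) ⟩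
      (eval r x * eval r x ^ m) * (eval r x * eval r x ^ m) ≡⟨ regroup (eval r x) (eval r x ^ m) ⟩
      (eval r x * (eval r x * eval r x ^ m)) * eval r x ^ m ≡⟨ cong₂ _*_ (eval-^ r (suc (suc m)) x) (eval-^ r m x) ⟨
      eval (r ^ᴾ suc (suc m)) x * eval (r ^ᴾ m) x        ≡⟨ eval-* (r ^ᴾ suc (suc m)) (r ^ᴾ m) x ⟨
      eval (r ^ᴾ suc (suc m) *ᴾ r ^ᴾ m) x                ∎
      where
      open ≡-Reasoning
      regroup : ∀ e y → (e * y) * (e * y) ≡ (e * (e * y)) * y
      regroup = solve-∀
    T²≈0 : T *ᴹ T ≈ᴹ 0ᴹ
    T²≈0 = begin
      T *ᴹ T                                                 ≈⟨ ≈ᴹ-sym (evalᴹ-*ᴾ (r ^ᴾ suc m) (r ^ᴾ suc m)) ⟩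
      evalᴹ (r ^ᴾ suc m *ᴾ r ^ᴾ suc m)                       ≈⟨ evalᴹ-resp-eval (r ^ᴾ suc m *ᴾ r ^ᴾ suc m) (r ^ᴾ suc (suc m) *ᴾ r ^ᴾ m) split ⟩
      evalᴹ (r ^ᴾ suc (suc m) *ᴾ r ^ᴾ m)                     ≈⟨ evalᴹ-*ᴾ (r ^ᴾ suc (suc m)) (r ^ᴾ m) ⟩
      evalᴹ (r ^ᴾ suc (suc m)) *ᴹ evalᴹ (r ^ᴾ m)             ≈⟨ *ᴹ-congʳ (evalᴹ (r ^ᴾ m)) rᵐ⁺²≈0 ⟩
      0ᴹ *ᴹ evalᴹ (r ^ᴾ m)                                   ≈⟨ *ᴹ-zeroˡ (evalᴹ (r ^ᴾ m)) ⟩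
      0ᴹ                                                     ∎
      where open ≈ᴹ-Reasoning

  evalᴹ-telescope : ∀ p (C : ℕ → Mat n) → (∀ l → coeff p l •ᴹ 1ᴹ ≈ᴹ C l -ᴹ A *ᴹ C (suc l)) →
    (∀ l → length p ℕ.≤ l → C (suc l) ≈ᴹ 0ᴹ) → evalᴹ p ≈ᴹ C zero
  evalᴹ-telescope []      C rel vanish i j = begin
    0ℤ                                      ≡⟨ ℤ.*-zeroˡ (δ i j) ⟨
    0ℤ * δ i j                              ≡⟨ rel zero i j ⟩
    C zero i j - (A *ᴹ C 1) i j             ≡⟨ cong (λ x → C zero i j - x) (trans (*ᴹ-congˡ A (vanish zero z≤n) i j) (*ᴹ-zeroʳ A i j)) ⟩
    C zero i j - 0ℤ                         ≡⟨ ℤ.+-identityʳ (C zero i j) ⟩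
    C zero i j                              ∎
    where open ≡-Reasoning
  evalᴹ-telescope (c ∷ p) C rel vanish i j = begin
    c * δ i j + (A *ᴹ evalᴹ p) i j          ≡⟨ cong (_+_ (c * δ i j)) (*ᴹ-congˡ A (evalᴹ-telescope p (C ∘ suc) (rel ∘ suc) (λ l → vanish (suc l) ∘ s≤s)) i j) ⟩
    c * δ i j + (A *ᴹ C 1) i j              ≡⟨ cong (_+ (A *ᴹ C 1) i j) (rel zero i j) ⟩
    C zero i j - (A *ᴹ C 1) i j + (A *ᴹ C 1) i j ≡⟨ cancel (C zero i j) ((A *ᴹ C 1) i j) ⟩
    C zero i j                              ∎
    where
    open ≡-Reasoning
    cancel : ∀ x y → x - y + y ≡ x
    cancel = solve-∀

trace : ∀ {n} → Mat n → ℤ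
trace M = sum (λ i → M i i)

ZeroDiagonal : ∀ {n} → Mat n → Set
ZeroDiagonal M = ∀ i → M i i ≡ 0ℤ

trace-A²-minor : ∀ {n} (A : Mat (suc n)) → A zero zero ≡ 0ℤ →
  trace (A *ᴹ A) ≡ trace (minor A zero zero *ᴹ minor A zero zero) + + 2 * sum (λ j → A zero j * A j zero)
trace-A²-minor A A₀₀≡0 = begin
  trace (A *ᴹ A)
    ≡⟨ cong (_+_ (sum (λ s → A zero s * A s zero))) (∑-distrib-+ (λ r → A (suc r) zero * A zero (suc r)) (λ r → (A′ *ᴹ A′) r r)) ⟩
  A zero zero * A zero zero + Y + (sum (λ r → A (suc r) zero * A zero (suc r)) + trace (A′ *ᴹ A′))
    ≡⟨ cong (λ t → A zero zero * A zero zero + Y + (t + trace (A′ *ᴹ A′))) (sum-cong-≗ (λ r → ℤ.*-comm (A (suc r) zero) (A zero (suc r)))) ⟩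
  A zero zero * A zero zero + Y + (Y + trace (A′ *ᴹ A′))
    ≡⟨ cong (λ a → a * a + Y + (Y + trace (A′ *ᴹ A′))) A₀₀≡0 ⟩
  0ℤ * 0ℤ + Y + (Y + trace (A′ *ᴹ A′))
    ≡⟨ regroup Y (trace (A′ *ᴹ A′)) ⟩
  trace (A′ *ᴹ A′) + + 2 * (0ℤ * 0ℤ + Y)
    ≡⟨ cong (λ a → trace (A′ *ᴹ A′) + + 2 * (a * a + Y)) A₀₀≡0 ⟨
  trace (A′ *ᴹ A′) + + 2 * sum (λ j → A zero j * A j zero) ∎
  where
  open ≡-Reasoning
  A′ = minor A zero zero
  Y = sum (λ s → A zero (suc s) * A (suc s) zero)
  regroup : ∀ y t → 0ℤ * 0ℤ + y + (y + t) ≡ t + + 2 * (0ℤ * 0ℤ + y)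
  regroup = solve-∀

trace-1ᴹ : ∀ n → trace (1ᴹ {n}) ≡ + n
trace-1ᴹ n = trans (sum-cong-≗ {n} {x = λ i → δ i i} {y = λ _ → 1ℤ} δ-refl) (sum-ones n)

trace--ᴹ : ∀ {n} (M N : Mat n) → trace (M -ᴹ N) ≡ trace M - trace N
trace--ᴹ M N = sum-distrib-minus (λ i → M i i) (λ i → N i i)

-- The characteristic polynomial

module _ {n : ℕ} (A : Mat n) where

  charMatrix : ℤ → Mat n
  charMatrix x i j = (if ⌊ i ≟ j ⌋ then x else 0ℤ) - A i j

  charMatrixᴾ : Fin n → Fin n → Poly
  charMatrixᴾ i j = if ⌊ i ≟ j ⌋ then linear (- A i j) else constᴾ (- A i j)

  eval-charMatrixᴾ : ∀ i j x → eval (charMatrixᴾ i j) x ≡ charMatrix x i j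
  eval-charMatrixᴾ i j x with i ≟ j
  ... | yes _ = eval-linear (- A i j) x
  ... | no _  = trans (eval-const (- A i j) x) (sym (ℤ.+-identityˡ (- A i j)))

  Deg≤-charMatrixᴾ : ∀ i j → Deg≤ 1 (charMatrixᴾ i j)
  Deg≤-charMatrixᴾ i j with i ≟ j
  ... | yes _ = Deg≤-linear (- A i j)
  ... | no _  = Deg≤-mono {p = constᴾ (- A i j)} z≤n (Deg≤-const (- A i j))

  coeff-charMatrixᴾ* : ∀ i j q l → coeff (charMatrixᴾ i j *ᴾ q) l ≡ - A i j * coeff q l + δ i j * coeff (shift q) l
  coeff-charMatrixᴾ* i j q l with i ≟ j
  ... | yes _ = trans (coeff-linear* (- A i j) q l) (cong (_+_ (- A i j * coeff q l)) (sym (ℤ.*-identityˡ _)))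
  ... | no _  = trans (coeff-const* (- A i j) q l) (sym (trans (cong (_+_ (- A i j * coeff q l)) (ℤ.*-zeroˡ (coeff (shift q) l))) (ℤ.+-identityʳ _)))

  charᴾ : Poly
  charᴾ = detᴾ charMatrixᴾ

  eval-charᴾ : ∀ x → eval charᴾ x ≡ charPoly A x
  eval-charᴾ x = trans (eval-det charMatrixᴾ x) (det-cong (λ i j → eval-charMatrixᴾ i j x))

module _ {n : ℕ} (A : Mat (suc n)) where
  open ≡-Reasoning

  -- Entry (k , j) of the cofactor matrix of xI − A; the adjugate is its transpose.
  adjugateᴾ : Fin (suc n) → Fin (suc n) → Poly
  adjugateᴾ k j = constᴾ (altSign (toℕ k ℕ.+ toℕ j)) *ᴾ detᴾ (minor (charMatrixᴾ A) k j)

  eval-adjugateᴾ : ∀ k j x → eval (adjugateᴾ k j) x ≡ cofactor (charMatrix A x) k j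
  eval-adjugateᴾ k j x = begin
    eval (adjugateᴾ k j) x
      ≡⟨ eval-* (constᴾ (altSign (toℕ k ℕ.+ toℕ j))) (detᴾ (minor (charMatrixᴾ A) k j)) x ⟩
    eval (constᴾ (altSign (toℕ k ℕ.+ toℕ j))) x * eval (detᴾ (minor (charMatrixᴾ A) k j)) x
      ≡⟨ cong₂ _*_ (eval-const (altSign (toℕ k ℕ.+ toℕ j)) x) (eval-det (minor (charMatrixᴾ A) k j) x) ⟩
    altSign (toℕ k ℕ.+ toℕ j) * det (λ r t → eval (charMatrixᴾ A (punchIn k r) (punchIn j t)) x)
      ≡⟨ cong (altSign (toℕ k ℕ.+ toℕ j) *_) (det-cong (λ r t → eval-charMatrixᴾ A (punchIn k r) (punchIn j t) x)) ⟩
    cofactor (charMatrix A x) k j ∎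

  Deg≤-adjugateᴾ : ∀ k j → Deg≤ n (adjugateᴾ k j)
  Deg≤-adjugateᴾ k j = Deg≤-* 0 n (constᴾ (altSign (toℕ k ℕ.+ toℕ j))) (detᴾ (minor (charMatrixᴾ A) k j))
    (Deg≤-const _) (Deg≤-det (minor (charMatrixᴾ A) k j) (λ r t → Deg≤-charMatrixᴾ A (punchIn k r) (punchIn j t)))

  -- Entry (i , k) is the coefficient of x^(l−1) in adj(xI − A).
  adjugateCoeff : ℕ → Mat (suc n)
  adjugateCoeff l i k = coeff (shift (adjugateᴾ k i)) l

  -- The coefficients of adj(xI − A) (xI − A) = charPoly(x) I.
  adjugateCoeff-relation : ∀ l i k → adjugateCoeff l i k - (A *ᴹ adjugateCoeff (suc l)) i k ≡ δ i k * coeff (charᴾ A) l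
  adjugateCoeff-relation l i k = begin
    adjugateCoeff l i k - (A *ᴹ adjugateCoeff (suc l)) i k
      ≡⟨ cong₂ _-_ (sum-δˡ i (λ j → adjugateCoeff l j k)) refl ⟨
    sum (λ j → δ i j * adjugateCoeff l j k) - sum (λ j → A i j * adjugateCoeff (suc l) j k)
      ≡⟨ sum-distrib-minus (λ j → δ i j * adjugateCoeff l j k) (λ j → A i j * adjugateCoeff (suc l) j k) ⟨
    sum (λ j → δ i j * adjugateCoeff l j k - A i j * adjugateCoeff (suc l) j k)
      ≡⟨ sum-cong-≗ (λ j → trans (reorder (δ i j) (adjugateCoeff l j k) (A i j) (adjugateCoeff (suc l) j k))
                                   (sym (coeff-charMatrixᴾ* A i j (adjugateᴾ k j) l))) ⟩
    sum (λ j → coeff (charMatrixᴾ A i j *ᴾ adjugateᴾ k j) l)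
      ≡⟨ coeff-sum (λ j → charMatrixᴾ A i j *ᴾ adjugateᴾ k j) l ⟨
    coeff (sumᴾ (λ j → charMatrixᴾ A i j *ᴾ adjugateᴾ k j)) l
      ≡⟨ coeff-unique (sumᴾ (λ j → charMatrixᴾ A i j *ᴾ adjugateᴾ k j)) (δ i k •ᴾ charᴾ A) evaluations l ⟩
    coeff (δ i k •ᴾ charᴾ A) l
      ≡⟨ coeff-• (δ i k) (charᴾ A) l ⟩
    δ i k * coeff (charᴾ A) l ∎
    where
    reorder : ∀ d m a c → d * m - a * c ≡ - a * c + d * m
    reorder = solve-∀
    evaluations : ∀ x → eval (sumᴾ (λ j → charMatrixᴾ A i j *ᴾ adjugateᴾ k j)) x ≡ eval (δ i k •ᴾ charᴾ A) x
    evaluations x = begin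
      eval (sumᴾ (λ j → charMatrixᴾ A i j *ᴾ adjugateᴾ k j)) x
        ≡⟨ eval-sum (λ j → charMatrixᴾ A i j *ᴾ adjugateᴾ k j) x ⟩
      sum (λ j → eval (charMatrixᴾ A i j *ᴾ adjugateᴾ k j) x)
        ≡⟨ sum-cong-≗ (λ j → trans (eval-* (charMatrixᴾ A i j) (adjugateᴾ k j) x)
                                    (cong₂ _*_ (eval-charMatrixᴾ A i j x) (eval-adjugateᴾ k j x))) ⟩
      sum (λ j → charMatrix A x i j * cofactor (charMatrix A x) k j)
        ≡⟨ adjugate-identity (charMatrix A x) i k ⟩
      δ i k * det (charMatrix A x)
        ≡⟨ cong (δ i k *_) (eval-charᴾ A x) ⟨
      δ i k * eval (charᴾ A) x
        ≡⟨ eval-• (δ i k) (charᴾ A) x ⟨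
      eval (δ i k •ᴾ charᴾ A) x ∎

  adjugateᴾ₀₀ : ∀ l → coeff (adjugateᴾ zero zero) l ≡ coeff (charᴾ (minor A zero zero)) l
  adjugateᴾ₀₀ = coeff-unique (adjugateᴾ zero zero) (charᴾ (minor A zero zero)) evaluations
    where
    suc≟suc : ∀ {m} (r t : Fin m) → ⌊ suc r ≟ suc t ⌋ ≡ ⌊ r ≟ t ⌋
    suc≟suc r t with r ≟ t | suc r ≟ suc t
    ... | yes _   | yes _   = refl
    ... | no _    | no _    = refl
    ... | yes r≡t | no r≢t  = contradiction (cong suc r≡t) r≢t
    ... | no r≢t  | yes r≡t = contradiction (suc-injective r≡t) r≢t
    evaluations : ∀ x → eval (adjugateᴾ zero zero) x ≡ eval (charᴾ (minor A zero zero)) x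
    evaluations x = begin
      eval (adjugateᴾ zero zero) x                ≡⟨ eval-adjugateᴾ zero zero x ⟩
      1ℤ * det (minor (charMatrix A x) zero zero) ≡⟨ ℤ.*-identityˡ _ ⟩
      det (minor (charMatrix A x) zero zero)      ≡⟨ det-cong (λ r t → cong (λ b → (if b then x else 0ℤ) - A (suc r) (suc t)) (suc≟suc r t)) ⟩
      charPoly (minor A zero zero) x              ≡⟨ eval-charᴾ (minor A zero zero) x ⟨
      eval (charᴾ (minor A zero zero)) x          ∎

  adjugateᴾ-top : ∀ i k → adjugateCoeff (suc n) i k ≡ δ i k * coeff (charᴾ A) (suc n)
  adjugateᴾ-top i k = begin
    adjugateCoeff (suc n) i k                                      ≡⟨ ℤ.+-identityʳ _ ⟨
    adjugateCoeff (suc n) i k - 0ℤ                                 ≡⟨ cong (_-_ (adjugateCoeff (suc n) i k)) (sum-zero (λ j → A i j * adjugateCoeff (suc (suc n)) j k) beyond-degree) ⟨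
    adjugateCoeff (suc n) i k - (A *ᴹ adjugateCoeff (suc (suc n))) i k ≡⟨ adjugateCoeff-relation (suc n) i k ⟩
    δ i k * coeff (charᴾ A) (suc n)                                ∎
    where
    beyond-degree : ∀ j → A i j * adjugateCoeff (suc (suc n)) j k ≡ 0ℤ
    beyond-degree j = trans (cong (A i j *_) (Deg≤-adjugateᴾ k j (suc n) (ℕ.n<1+n n))) (ℤ.*-zeroʳ (A i j))

charᴾ-monic : ∀ {N} (A : Mat N) → coeff (charᴾ A) N ≡ 1ℤ
charᴾ-monic {zero}  A = refl
charᴾ-monic {suc n} A = begin
  coeff (charᴾ A) (suc n)                     ≡⟨ ℤ.*-identityˡ _ ⟨
  1ℤ * coeff (charᴾ A) (suc n)                ≡⟨ adjugateᴾ-top A zero zero ⟨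
  coeff (adjugateᴾ A zero zero) n             ≡⟨ adjugateᴾ₀₀ A n ⟩
  coeff (charᴾ (minor A zero zero)) n         ≡⟨ charᴾ-monic (minor A zero zero) ⟩
  1ℤ                                          ∎
  where open ≡-Reasoning

cayley-hamilton : ∀ {N} (A : Mat N) → evalᴹ A (charᴾ A) ≈ᴹ 0ᴹ
cayley-hamilton {zero}  A ()
cayley-hamilton {suc n} A = evalᴹ-telescope A (charᴾ A) (adjugateCoeff A) relation vanish
  where
  relation : ∀ l → coeff (charᴾ A) l •ᴹ 1ᴹ ≈ᴹ adjugateCoeff A l -ᴹ A *ᴹ adjugateCoeff A (suc l)
  relation l i k = trans (ℤ.*-comm _ (δ i k)) (sym (adjugateCoeff-relation A l i k))
  vanish : ∀ l → length (charᴾ A) ℕ.≤ l → adjugateCoeff A (suc l) ≈ᴹ 0ᴹ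
  vanish l len≤l i k = Deg≤-adjugateᴾ A k i l (ℕ.<-trans (ℕ.n<1+n n) (ℕ.<-≤-trans (coeff≢0⇒<length (charᴾ A) (suc n) lead≢0) len≤l))
    where
    lead≢0 : coeff (charᴾ A) (suc n) ≢ 0ℤ
    lead≢0 lead≡0 = 1≢0 (trans (sym (charᴾ-monic A)) lead≡0)
      where
      1≢0 : 1ℤ ≢ 0ℤ
      1≢0 ()

charᴾ-MonicTop : ∀ {N} (A : Mat N) → ZeroDiagonal A → MonicTop (charᴾ A) N 0ℤ (trace (A *ᴹ A))
charᴾ-MonicTop {zero}  A _ = record { deg≤ = Deg≤-const 1ℤ ; lead = refl ; next₁ = refl ; next₂ = refl }
charᴾ-MonicTop {suc n} A A-zd = record
  { deg≤  = Deg≤-det (charMatrixᴾ A) (Deg≤-charMatrixᴾ A)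
  ; lead  = charᴾ-monic A
  ; next₁ = subleading≡0
  ; next₂ = next₂ n refl
  }
  where
  open ≡-Reasoning
  A′ = minor A zero zero
  module IH = MonicTop (charᴾ-MonicTop A′ (A-zd ∘ suc))

  adjugate-lead : ∀ i k → adjugateCoeff A (suc n) i k ≡ δ i k
  adjugate-lead i k = trans (adjugateᴾ-top A i k) (trans (cong (δ i k *_) (charᴾ-monic A)) (ℤ.*-identityʳ (δ i k)))

  adjugate-next : ∀ i k → adjugateCoeff A n i k ≡ δ i k * coeff (charᴾ A) n + A i k
  adjugate-next i k = begin
    adjugateCoeff A n i k                                            ≡⟨ cancel (adjugateCoeff A n i k) (A i k) ⟩
    adjugateCoeff A n i k - A i k + A i k                            ≡⟨ cong (λ t → adjugateCoeff A n i k - t + A i k)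
                                                                          (trans (sum-cong-≗ (λ j → cong (A i j *_) (adjugate-lead j k))) (sum-δʳ k (A i))) ⟨
    adjugateCoeff A n i k - (A *ᴹ adjugateCoeff A (suc n)) i k + A i k ≡⟨ cong (_+ A i k) (adjugateCoeff-relation A n i k) ⟩
    δ i k * coeff (charᴾ A) n + A i k                                ∎
    where
    cancel : ∀ c a → c ≡ c - a + a
    cancel = solve-∀

  adjugate-shift₀₀ : ∀ l → adjugateCoeff A l zero zero ≡ coeff (shift (charᴾ A′)) l
  adjugate-shift₀₀ = coeff-shift-cong (adjugateᴾ A zero zero) (charᴾ A′) (adjugateᴾ₀₀ A)

  subleading≡0 : coeff (charᴾ A) n ≡ 0ℤ
  subleading≡0 = begin
    coeff (charᴾ A) n                            ≡⟨ ℤ.+-identityʳ (coeff (charᴾ A) n) ⟨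
    coeff (charᴾ A) n + 0ℤ                       ≡⟨ cong₂ _+_ (ℤ.*-identityˡ (coeff (charᴾ A) n)) (A-zd zero) ⟨
    1ℤ * coeff (charᴾ A) n + A zero zero         ≡⟨ adjugate-next zero zero ⟨
    adjugateCoeff A n zero zero                  ≡⟨ adjugate-shift₀₀ n ⟩
    coeff (shift (charᴾ A′)) n                   ≡⟨ IH.next₁ ⟩
    0ℤ                                           ∎

  adjugate-next′ : ∀ i k → adjugateCoeff A n i k ≡ A i k
  adjugate-next′ i k = trans (adjugate-next i k) (trans (cong (λ p → δ i k * p + A i k) subleading≡0)
                              (trans (cong (_+ A i k) (ℤ.*-zeroʳ (δ i k))) (ℤ.+-identityˡ (A i k))))

  next₂ : ∀ m → n ≡ m → + 2 * coeff (shift (charᴾ A)) n ≡ 0ℤ * 0ℤ - trace (A *ᴹ A)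
  next₂ zero    refl = sym (cong (λ a → 0ℤ * 0ℤ - (a * a + 0ℤ + 0ℤ)) (A-zd zero))
  next₂ (suc m) refl = begin
    + 2 * coeff (charᴾ A) m
      ≡⟨ cong (+ 2 *_) (trans (sym (ℤ.*-identityˡ _)) (sym (adjugateCoeff-relation A m zero zero))) ⟩
    + 2 * (adjugateCoeff A m zero zero - (A *ᴹ adjugateCoeff A (suc m)) zero zero)
      ≡⟨ cong₂ (λ a s → + 2 * (a - s)) (adjugate-shift₀₀ m) (sum-cong-≗ (λ j → cong (A zero j *_) (adjugate-next′ j zero))) ⟩
    + 2 * (coeff (shift (shift (charᴾ A′))) n - sum (λ j → A zero j * A j zero))
      ≡⟨ distrib (coeff (shift (shift (charᴾ A′))) n) (sum (λ j → A zero j * A j zero)) ⟩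
    + 2 * coeff (shift (shift (charᴾ A′))) n - + 2 * sum (λ j → A zero j * A j zero)
      ≡⟨ cong (λ t → t - + 2 * sum (λ j → A zero j * A j zero)) IH.next₂ ⟩
    0ℤ * 0ℤ - trace (A′ *ᴹ A′) - + 2 * sum (λ j → A zero j * A j zero)
      ≡⟨ collect (trace (A′ *ᴹ A′)) (+ 2 * sum (λ j → A zero j * A j zero)) ⟩
    0ℤ * 0ℤ - (trace (A′ *ᴹ A′) + + 2 * sum (λ j → A zero j * A j zero))
      ≡⟨ cong (λ t → 0ℤ * 0ℤ - t) (trace-A²-minor A (A-zd zero)) ⟨
    0ℤ * 0ℤ - trace (A *ᴹ A) ∎
    where
    distrib : ∀ c s → + 2 * (c - s) ≡ + 2 * c - + 2 * s
    distrib = solve-∀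
    collect : ∀ t s → 0ℤ * 0ℤ - t - s ≡ 0ℤ * 0ℤ - (t + s)
    collect = solve-∀

-- Symmetric matrices with spectrum μ, 1, …, 1, −1, …, −1

private
  ^-distrib-* : ∀ x y n → (x * y) ^ n ≡ x ^ n * y ^ n
  ^-distrib-* x y zero    = refl
  ^-distrib-* x y (suc n) = trans (cong (x * y *_) (^-distrib-* x y n)) (regroup x y (x ^ n) (y ^ n))
    where
    regroup : ∀ x y u v → x * y * (u * v) ≡ x * u * (y * v)
    regroup = solve-∀

module _ (a b : ℕ) (μ : ℤ) (A : Mat (suc (a ℕ.+ b))) (A-sym : Symmetric A) (A-zd : ZeroDiagonal A)
         (charPoly≡ : ∀ x → charPoly A x ≡ (x - μ) * (x - 1ℤ) ^ a * (x + 1ℤ) ^ b) where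

  Qᴾ : Poly
  Qᴾ = linear (- μ) *ᴾ linear^* (- 1ℤ) a (linear^* 1ℤ b (constᴾ 1ℤ))

  eval-Qᴾ : ∀ x → eval Qᴾ x ≡ (x - μ) * (x - 1ℤ) ^ a * (x + 1ℤ) ^ b
  eval-Qᴾ x = begin
    eval Qᴾ x
      ≡⟨ eval-* (linear (- μ)) (linear^* (- 1ℤ) a (linear^* 1ℤ b (constᴾ 1ℤ))) x ⟩
    eval (linear (- μ)) x * eval (linear^* (- 1ℤ) a (linear^* 1ℤ b (constᴾ 1ℤ))) x
      ≡⟨ cong₂ _*_ (eval-linear (- μ) x) (trans (eval-linear^* (- 1ℤ) a _ x) (cong ((x - 1ℤ) ^ a *_)
                   (trans (eval-linear^* 1ℤ b (constᴾ 1ℤ) x) (cong ((x + 1ℤ) ^ b *_) (eval-const 1ℤ x))))) ⟩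
    (x - μ) * ((x - 1ℤ) ^ a * ((x + 1ℤ) ^ b * 1ℤ))
      ≡⟨ regroup (x - μ) ((x - 1ℤ) ^ a) ((x + 1ℤ) ^ b) ⟩
    (x - μ) * (x - 1ℤ) ^ a * (x + 1ℤ) ^ b ∎
    where
    open ≡-Reasoning
    regroup : ∀ u v w → u * (v * (w * 1ℤ)) ≡ u * v * w
    regroup = solve-∀

  charᴾ≈Qᴾ : ∀ l → coeff (charᴾ A) l ≡ coeff Qᴾ l
  charᴾ≈Qᴾ = coeff-unique (charᴾ A) Qᴾ (λ x → trans (eval-charᴾ A x) (trans (charPoly≡ x) (sym (eval-Qᴾ x))))

  trace-A² : trace (A *ᴹ A) ≡ μ * μ + + a + + b
  trace-A² = trans (proj₂ (MonicTop-unique (MonicTop-resp charᴾ≈Qᴾ (charᴾ-MonicTop A A-zd)) Q-top)) (normalise μ (+ a) (+ b))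
    where
    s V : ℤ
    s = 0ℤ + + b * 1ℤ + + a * - 1ℤ + - μ
    V = 0ℤ + + b * (1ℤ * 1ℤ) + + a * (- 1ℤ * - 1ℤ) + - μ * - μ
    Q-top : MonicTop Qᴾ (suc (a ℕ.+ b)) s V
    Q-top = subst (λ d → MonicTop Qᴾ (suc d) s V) (cong (a ℕ.+_) (ℕ.+-identityʳ b))
                  (MonicTop-linear* (- μ) (MonicTop-linear^* (- 1ℤ) a (MonicTop-linear^* 1ℤ b MonicTop-const1)))
    normalise : ∀ m a b → 0ℤ + b * (1ℤ * 1ℤ) + a * (- 1ℤ * - 1ℤ) + - m * - m ≡ m * m + a + b
    normalise = solve-∀

  trace-A²-I : trace (A *ᴹ A -ᴹ 1ᴹ) ≡ μ * μ - 1ℤ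
  trace-A²-I = begin
    trace (A *ᴹ A -ᴹ 1ᴹ)                          ≡⟨ trace--ᴹ (A *ᴹ A) 1ᴹ ⟩
    trace (A *ᴹ A) - trace (1ᴹ {suc (a ℕ.+ b)})   ≡⟨ cong₂ _-_ trace-A² (trace-1ᴹ (suc (a ℕ.+ b))) ⟩
    μ * μ + + a + + b - + suc (a ℕ.+ b)           ≡⟨ cong (λ t → μ * μ + + a + + b - t) (trans (ℤ.pos-+ 1 (a ℕ.+ b)) (cong (_+_ 1ℤ) (ℤ.pos-+ a b))) ⟩
    μ * μ + + a + + b - (1ℤ + (+ a + + b))        ≡⟨ cancel μ (+ a) (+ b) ⟩
    μ * μ - 1ℤ                                    ∎
    where
    open ≡-Reasoning
    cancel : ∀ m a b → m * m + a + b - (1ℤ + (a + b)) ≡ m * m - 1ℤ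
    cancel = solve-∀

  Rᴾ : Poly
  Rᴾ = linear (- μ) *ᴾ (linear (- 1ℤ) *ᴾ linear 1ℤ)

  eval-Rᴾ : ∀ x → eval Rᴾ x ≡ (x - μ) * ((x - 1ℤ) * (x + 1ℤ))
  eval-Rᴾ x = trans (eval-* (linear (- μ)) (linear (- 1ℤ) *ᴾ linear 1ℤ) x)
    (cong₂ _*_ (eval-linear (- μ) x) (trans (eval-* (linear (- 1ℤ)) (linear 1ℤ) x) (cong₂ _*_ (eval-linear (- 1ℤ) x) (eval-linear 1ℤ x))))

  -- Rᴺ = Q W with N = 1 + a + b, so R(A) is nilpotent by Cayley–Hamilton, hence zero as A is symmetric.
  Rᴾ-vanishes : evalᴹ A Rᴾ ≈ᴹ 0ᴹ
  Rᴾ-vanishes = evalᴹ-nilpotent A A-sym Rᴾ (a ℕ.+ b) (begin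
    evalᴹ A (Rᴾ ^ᴾ suc (a ℕ.+ b))   ≈⟨ evalᴹ-resp-eval A (Rᴾ ^ᴾ suc (a ℕ.+ b)) (Qᴾ *ᴾ Wᴾ) Rᴺ≡QW ⟩
    evalᴹ A (Qᴾ *ᴾ Wᴾ)              ≈⟨ evalᴹ-*ᴾ A Qᴾ Wᴾ ⟩
    evalᴹ A Qᴾ *ᴹ evalᴹ A Wᴾ        ≈⟨ *ᴹ-congʳ (evalᴹ A Wᴾ) (≈ᴹ-trans (evalᴹ-coeff A Qᴾ (charᴾ A) (sym ∘ charᴾ≈Qᴾ)) (cayley-hamilton A)) ⟩
    0ᴹ *ᴹ evalᴹ A Wᴾ                ≈⟨ *ᴹ-zeroˡ (evalᴹ A Wᴾ) ⟩
    0ᴹ                              ∎)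
    where
    open ≈ᴹ-Reasoning
    Wᴾ : Poly
    Wᴾ = linear^* (- μ) (a ℕ.+ b) (linear^* (- 1ℤ) (suc b) (linear^* 1ℤ (suc a) (constᴾ 1ℤ)))
    Rᴺ≡QW : ∀ x → eval (Rᴾ ^ᴾ suc (a ℕ.+ b)) x ≡ eval (Qᴾ *ᴾ Wᴾ) x
    Rᴺ≡QW x = Eq.begin
      eval (Rᴾ ^ᴾ suc (a ℕ.+ b)) x
        Eq.≡⟨ trans (eval-^ Rᴾ (suc (a ℕ.+ b)) x) (cong (_^ suc (a ℕ.+ b)) (eval-Rᴾ x)) ⟩
      (u * (v * w)) ^ suc (a ℕ.+ b)
        Eq.≡⟨ trans (^-distrib-* u (v * w) (suc (a ℕ.+ b))) (cong (u ^ suc (a ℕ.+ b) *_) (^-distrib-* v w (suc (a ℕ.+ b)))) ⟩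
      u * u ^ (a ℕ.+ b) * (v ^ suc (a ℕ.+ b) * w ^ suc (a ℕ.+ b))
        Eq.≡⟨ cong₂ (λ i j → u * u ^ (a ℕ.+ b) * (v ^ i * w ^ j)) (sym (ℕ.+-suc a b)) (trans (cong suc (ℕ.+-comm a b)) (sym (ℕ.+-suc b a))) ⟩
      u * u ^ (a ℕ.+ b) * (v ^ (a ℕ.+ suc b) * w ^ (b ℕ.+ suc a))
        Eq.≡⟨ cong₂ (λ p q → u * u ^ (a ℕ.+ b) * (p * q)) (ℤ.^-distribˡ-+-* v a (suc b)) (ℤ.^-distribˡ-+-* w b (suc a)) ⟩
      u * u ^ (a ℕ.+ b) * (v ^ a * v ^ suc b * (w ^ b * w ^ suc a))
        Eq.≡⟨ regroup u (u ^ (a ℕ.+ b)) (v ^ a) (v ^ suc b) (w ^ b) (w ^ suc a) ⟩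
      u * v ^ a * w ^ b * (u ^ (a ℕ.+ b) * (v ^ suc b * (w ^ suc a * 1ℤ)))
        Eq.≡⟨ cong₂ _*_ (eval-Qᴾ x) (trans (eval-linear^* (- μ) (a ℕ.+ b) _ x) (cong (u ^ (a ℕ.+ b) *_)
               (trans (eval-linear^* (- 1ℤ) (suc b) _ x) (cong (v ^ suc b *_)
                 (trans (eval-linear^* 1ℤ (suc a) (constᴾ 1ℤ) x) (cong (w ^ suc a *_) (eval-const 1ℤ x))))))) ⟨
      eval Qᴾ x * eval Wᴾ x
        Eq.≡⟨ eval-* Qᴾ Wᴾ x ⟨
      eval (Qᴾ *ᴾ Wᴾ) x Eq.∎
      where
      module Eq = ≡-Reasoning
      u = x - μ
      v = x - 1ℤ
      w = x + 1ℤ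
      regroup : ∀ u U v₁ v₂ w₁ w₂ → u * U * (v₁ * v₂ * (w₁ * w₂)) ≡ u * v₁ * w₁ * (U * (v₂ * (w₂ * 1ℤ)))
      regroup = solve-∀

  Bᴾ : Poly
  Bᴾ = - 1ℤ ∷ 0ℤ ∷ 1ℤ ∷ []

  evalᴹ-Bᴾ : evalᴹ A Bᴾ ≈ᴹ A *ᴹ A -ᴹ 1ᴹ
  evalᴹ-Bᴾ i j = begin
    - 1ℤ * δ i j + (A *ᴹ evalᴹ A (0ℤ ∷ 1ℤ ∷ [])) i j   ≡⟨ cong₂ _+_ (ℤ.-1*i≡-i (δ i j)) (*ᴹ-congˡ A evalᴹ-X i j) ⟩
    - δ i j + (A *ᴹ A) i j                             ≡⟨ ℤ.+-comm (- δ i j) ((A *ᴹ A) i j) ⟩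
    (A *ᴹ A) i j - δ i j                               ∎
    where
    open ≡-Reasoning
    evalᴹ-X : evalᴹ A (0ℤ ∷ 1ℤ ∷ []) ≈ᴹ A
    evalᴹ-X = ≈ᴹ-trans (0•1ᴹ+ᴹ (A *ᴹ evalᴹ A (constᴾ 1ℤ))) (≈ᴹ-trans (*ᴹ-congˡ A (evalᴹ-const1 A)) (*ᴹ-identityʳ A))

  -- (x² − 1)² = (μ² − 1)(x² − 1) + (x − μ)(x − 1)(x + 1)(x + μ)
  A²-I-squared : (A *ᴹ A -ᴹ 1ᴹ) *ᴹ (A *ᴹ A -ᴹ 1ᴹ) ≈ᴹ (μ * μ - 1ℤ) •ᴹ (A *ᴹ A -ᴹ 1ᴹ)
  A²-I-squared = begin
    B *ᴹ B                                                   ≈⟨ *ᴹ-cong (≈ᴹ-sym evalᴹ-Bᴾ) (≈ᴹ-sym evalᴹ-Bᴾ) ⟩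
    evalᴹ A Bᴾ *ᴹ evalᴹ A Bᴾ                                 ≈⟨ ≈ᴹ-sym (evalᴹ-*ᴾ A Bᴾ Bᴾ) ⟩
    evalᴹ A (Bᴾ *ᴾ Bᴾ)                                       ≈⟨ evalᴹ-resp-eval A (Bᴾ *ᴾ Bᴾ) (c •ᴾ Bᴾ +ᴾ Rᴾ *ᴾ linear μ) B²≡cB+RL ⟩
    evalᴹ A (c •ᴾ Bᴾ +ᴾ Rᴾ *ᴾ linear μ)                      ≈⟨ evalᴹ-+ᴾ A (c •ᴾ Bᴾ) (Rᴾ *ᴾ linear μ) ⟩
    evalᴹ A (c •ᴾ Bᴾ) +ᴹ evalᴹ A (Rᴾ *ᴾ linear μ)            ≈⟨ +ᴹ-cong (≈ᴹ-trans (evalᴹ-•ᴾ A c Bᴾ) (•ᴹ-congˡ c evalᴹ-Bᴾ))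
                                                                        (≈ᴹ-trans (evalᴹ-*ᴾ A Rᴾ (linear μ)) (*ᴹ-congʳ (evalᴹ A (linear μ)) Rᴾ-vanishes)) ⟩
    c •ᴹ B +ᴹ 0ᴹ *ᴹ evalᴹ A (linear μ)                       ≈⟨ +ᴹ-congˡ (c •ᴹ B) (*ᴹ-zeroˡ (evalᴹ A (linear μ))) ⟩
    c •ᴹ B +ᴹ 0ᴹ                                             ≈⟨ (λ i j → ℤ.+-identityʳ (c * B i j)) ⟩
    c •ᴹ B                                                   ∎
    where
    open ≈ᴹ-Reasoning
    B = A *ᴹ A -ᴹ 1ᴹ
    c = μ * μ - 1ℤ
    B²≡cB+RL : ∀ x → eval (Bᴾ *ᴾ Bᴾ) x ≡ eval (c •ᴾ Bᴾ +ᴾ Rᴾ *ᴾ linear μ) x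
    B²≡cB+RL x = Eq.begin
      eval (Bᴾ *ᴾ Bᴾ) x                                    Eq.≡⟨ eval-* Bᴾ Bᴾ x ⟩
      eval Bᴾ x * eval Bᴾ x                                Eq.≡⟨ identity x μ ⟩
      c * eval Bᴾ x + (x - μ) * ((x - 1ℤ) * (x + 1ℤ)) * (x + μ)
        Eq.≡⟨ cong₂ (λ r l → c * eval Bᴾ x + r * l) (eval-Rᴾ x) (eval-linear μ x) ⟨
      c * eval Bᴾ x + eval Rᴾ x * eval (linear μ) x        Eq.≡⟨ cong₂ _+_ (eval-• c Bᴾ x) (eval-* Rᴾ (linear μ) x) ⟨
      eval (c •ᴾ Bᴾ) x + eval (Rᴾ *ᴾ linear μ) x           Eq.≡⟨ eval-+ (c •ᴾ Bᴾ) (Rᴾ *ᴾ linear μ) x ⟨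
      eval (c •ᴾ Bᴾ +ᴾ Rᴾ *ᴾ linear μ) x                   Eq.∎
      where
      module Eq = ≡-Reasoning
      identity : ∀ x m → (- 1ℤ + x * (0ℤ + x * (1ℤ + x * 0ℤ))) * (- 1ℤ + x * (0ℤ + x * (1ℤ + x * 0ℤ)))
                         ≡ (m * m - 1ℤ) * (- 1ℤ + x * (0ℤ + x * (1ℤ + x * 0ℤ))) + (x - m) * ((x - 1ℤ) * (x + 1ℤ)) * (x + m)
      identity = solve-∀

-- Symmetric matrices with B² = (trace B) B

private
  square-positive : ∀ {c} → c ≢ 0ℤ → ∃ λ k → c * c ≡ + suc k
  square-positive {+ zero}   c≢0 = contradiction refl c≢0
  square-positive {+[1+ m ]} _   = _ , refl
  square-positive { -[1+ m ]} _  = _ , refl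

  nonneg-cancel : ∀ k d → 0ℤ ≤ + suc k * d → 0ℤ ≤ d
  nonneg-cancel k (+ d)    _ = +≤+ z≤n
  nonneg-cancel k -[1+ d ] ()

module _ {n} (B : Mat n) (B-sym : Symmetric B) (B²≈cB : B *ᴹ B ≈ᴹ trace B •ᴹ B) where
  private
    open ≡-Reasoning
    c = trace B

    rows : ∀ u w → sum (λ x → B u x * B w x) ≡ c * B u w
    rows u w = trans (sum-cong-≗ (λ x → cong (B u x *_) (B-sym w x))) (B²≈cB u w)

    minor₂ : Fin n → Fin n → ℤ
    minor₂ u w = B u u * B w w - B u w * B u w

    minor₂-nonneg : c ≢ 0ℤ → ∀ u w → 0ℤ ≤ minor₂ u w
    minor₂-nonneg c≢0 u w with square-positive c≢0
    ... | k , c²≡ = nonneg-cancel k (minor₂ u w) (subst (0ℤ ≤_) scaled (cauchy-schwarz (B u) (B w)))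
      where
      factor : ∀ c x y z → c * x * (c * y) - c * z * (c * z) ≡ c * c * (x * y - z * z)
      factor = solve-∀
      scaled : sum (λ x → B u x * B u x) * sum (λ x → B w x * B w x) - sum (λ x → B u x * B w x) * sum (λ x → B u x * B w x)
               ≡ + suc k * minor₂ u w
      scaled = begin
        sum (λ x → B u x * B u x) * sum (λ x → B w x * B w x) - sum (λ x → B u x * B w x) * sum (λ x → B u x * B w x)
          ≡⟨ cong₂ (λ p q → p - q) (cong₂ _*_ (rows u u) (rows w w)) (cong₂ _*_ (rows u w) (rows u w)) ⟩
        c * B u u * (c * B w w) - c * B u w * (c * B u w)
          ≡⟨ factor c (B u u) (B w w) (B u w) ⟩
        c * c * minor₂ u w
          ≡⟨ cong (_* minor₂ u w) c²≡ ⟩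
        + suc k * minor₂ u w ∎

    minor₂-row-sum : ∀ u → sum (minor₂ u) ≡ 0ℤ
    minor₂-row-sum u = begin
      sum (minor₂ u)                                          ≡⟨ sum-distrib-minus (λ w → B u u * B w w) (λ w → B u w * B u w) ⟩
      sum (λ w → B u u * B w w) - sum (λ w → B u w * B u w)  ≡⟨ cong₂ _-_ (sym (*-distribˡ-sum (B u u) (λ w → B w w))) (rows u u) ⟩
      B u u * c - c * B u u                                   ≡⟨ cong (λ t → B u u * c - t) (ℤ.*-comm c (B u u)) ⟩
      B u u * c - B u u * c                                   ≡⟨ ℤ.+-inverseʳ (B u u * c) ⟩
      0ℤ                                                      ∎

  -- Cauchy–Schwarz makes every minor B u u · B w w − (B u w)² nonnegative when trace B ≢ 0,
  -- and the minors along a row sum to zero.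
  rank-one : ∀ u w → B u w * B u w ≡ B u u * B w w
  rank-one u w with c ℤ.≟ 0ℤ
  ... | yes c≡0 = trans (cong (λ x → x * x) (row≡0 u w)) (sym (trans (cong (_* B w w) (row≡0 u u)) (ℤ.*-zeroˡ (B w w))))
    where
    row≡0 : ∀ u x → B u x ≡ 0ℤ
    row≡0 u = sum-squares≡0 (B u) (trans (rows u u) (trans (cong (_* B u u) c≡0) (ℤ.*-zeroˡ (B u u))))
  ... | no c≢0 = begin
    B u w * B u w                      ≡⟨ ℤ.+-identityˡ (B u w * B u w) ⟨
    0ℤ + B u w * B u w                 ≡⟨ cong (_+ B u w * B u w) (sum-nonneg≡0 (minor₂ u) (minor₂-nonneg c≢0 u) (minor₂-row-sum u) w) ⟨
    minor₂ u w + B u w * B u w         ≡⟨ cancel (B u u * B w w) (B u w * B u w) ⟩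
    B u u * B w w                      ∎
    where
    cancel : ∀ x y → x - y + y ≡ x
    cancel = solve-∀

-- Signed graphs

IsSign : ℤ → Set
IsSign x = x ≡ 1ℤ ⊎ x ≡ - 1ℤ

IsSign-* : ∀ {x y} → IsSign x → IsSign y → IsSign (x * y)
IsSign-* (inj₁ refl) (inj₁ refl) = inj₁ refl
IsSign-* (inj₁ refl) (inj₂ refl) = inj₂ refl
IsSign-* (inj₂ refl) (inj₁ refl) = inj₂ refl
IsSign-* (inj₂ refl) (inj₂ refl) = inj₁ refl

IsSign-square : ∀ {x} → IsSign x → x * x ≡ 1ℤ
IsSign-square (inj₁ refl) = refl
IsSign-square (inj₂ refl) = refl

sign-of : ∀ β → ∃ λ ε → IsSign ε × ε * β ≡ + ∣ β ∣
sign-of (+ m)    = 1ℤ , inj₁ refl , ℤ.*-identityˡ (+ m)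
sign-of -[1+ m ] = - 1ℤ , inj₂ refl , ℤ.-1*i≡-i -[1+ m ]

private
  excess-term-nonneg : ∀ {e a b} → IsSign e → a ≡ 0ℤ ⊎ IsSign a → b ≡ 0ℤ ⊎ IsSign b → 0ℤ ≤ a * a - e * (a * b)
  excess-term-nonneg {e} {b = b} _  (inj₁ refl) _           = subst (0ℤ ≤_) (sym (vanish e b)) ℤ.≤-refl
    where
    vanish : ∀ e b → 0ℤ * 0ℤ - e * (0ℤ * b) ≡ 0ℤ
    vanish = solve-∀
  excess-term-nonneg {e} {a} _      (inj₂ _)    (inj₁ refl) = subst (0ℤ ≤_) (sym (drop e a)) (square-nonneg a)
    where
    drop : ∀ e a → a * a - e * (a * 0ℤ) ≡ a * a
    drop = solve-∀
  excess-term-nonneg {e} {a} {b} e± (inj₂ a±) (inj₂ b±) =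
    subst (0ℤ ≤_) (cong (_- e * (a * b)) (sym (IsSign-square a±))) (one-minus-sign (IsSign-* e± (IsSign-* a± b±)))
    where
    one-minus-sign : ∀ {s} → IsSign s → 0ℤ ≤ 1ℤ - s
    one-minus-sign (inj₁ refl) = +≤+ z≤n
    one-minus-sign (inj₂ refl) = +≤+ z≤n

  square-abs : ∀ i → + (∣ i ∣ ℕ.* ∣ i ∣) ≡ i * i
  square-abs i = trans (cong +_ (sym (ℤ.abs-* i i))) (ℤ.0≤i⇒+∣i∣≡i (square-nonneg i))

  squeeze : ∀ {p x y} → 0 ℕ.< p → p ℕ.≤ x → p ℕ.≤ y → p ℕ.* p ≡ x ℕ.* y → x ≡ p
  squeeze {suc p} {x} {y} _ p≤x p≤y p²≡xy = ℕ.≤-antisym (ℕ.≮⇒≥ x≮p) p≤x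
    where
    x≮p : ¬ (suc p ℕ.< x)
    x≮p p<x = ℕ.<-irrefl p²≡xy (ℕ.<-≤-trans (ℕ.*-monoˡ-< (suc p) p<x) (ℕ.*-monoʳ-≤ x p≤y))

  tight-term : ∀ {e a p} → IsSign e → a ≡ 1ℤ → a - e * p ≡ 0ℤ → p ≡ e
  tight-term {p = p} (inj₁ refl) refl 1-p≡0 = trans (recover p) (cong (_-_ 1ℤ) 1-p≡0)
    where
    recover : ∀ p → p ≡ 1ℤ - (1ℤ - 1ℤ * p)
    recover = solve-∀
  tight-term {p = p} (inj₂ refl) refl 1+p≡0 = trans (recover p) (cong (_- 1ℤ) 1+p≡0)
    where
    recover : ∀ p → p ≡ 1ℤ - - 1ℤ * p - 1ℤ
    recover = solve-∀

Adjacent : ∀ {n} → SignedGraph n → Fin n → Fin n → Set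
Adjacent G u v = adj G u v ≡ true

module _ {n} (G : SignedGraph n) where
  private
    A = adjMatrix G
    _∼_ = Adjacent G

  adjMatrix-sym : Symmetric A
  adjMatrix-sym u v = cong₂ (λ e s → if e then signToℤ s else 0ℤ) (adj-sym G u v) (sgn-sym G u v)

  adjMatrix-zeroDiagonal : ZeroDiagonal A
  adjMatrix-zeroDiagonal u = cong (λ e → if e then signToℤ (sgn G u u) else 0ℤ) (adj-irr G u)

  adjMatrix-entry : ∀ u v → (adj G u v ≡ false × A u v ≡ 0ℤ) ⊎ (u ∼ v × IsSign (A u v))
  adjMatrix-entry u v with adj G u v
  ... | false = inj₁ (refl , refl)
  ... | true  = inj₂ (refl , signToℤ-IsSign (sgn G u v))
    where
    signToℤ-IsSign : ∀ s → IsSign (signToℤ s)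
    signToℤ-IsSign pos = inj₁ refl
    signToℤ-IsSign neg = inj₂ refl

  adjMatrix-entry′ : ∀ u v → A u v ≡ 0ℤ ⊎ IsSign (A u v)
  adjMatrix-entry′ u v with adjMatrix-entry u v
  ... | inj₁ (_ , A≡0) = inj₁ A≡0
  ... | inj₂ (_ , ±1)  = inj₂ ±1

  adjacent⇒IsSign : ∀ {u v} → u ∼ v → IsSign (A u v)
  adjacent⇒IsSign {u} {v} u∼v with adjMatrix-entry u v
  ... | inj₁ (u≁v , _) = contradiction (trans (sym u∼v) u≁v) (λ ())
  ... | inj₂ (_ , ±1)  = ±1

  adjacent⇒square≡1 : ∀ {u v} → u ∼ v → A u v * A u v ≡ 1ℤ
  adjacent⇒square≡1 = IsSign-square ∘ adjacent⇒IsSign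

  nonzero⇒adjacent : ∀ {u v} → A u v ≢ 0ℤ → u ∼ v
  nonzero⇒adjacent {u} {v} A≢0 with adjMatrix-entry u v
  ... | inj₁ (_ , A≡0) = contradiction A≡0 A≢0
  ... | inj₂ (u∼v , _) = u∼v

  adjacent-sym : ∀ {u v} → u ∼ v → v ∼ u
  adjacent-sym {u} {v} u∼v = trans (adj-sym G v u) u∼v

  adjacent⇒≢ : ∀ {u v} → u ∼ v → u ≢ v
  adjacent⇒≢ {u} u∼u refl = contradiction (trans (sym u∼u) (adj-irr G u)) (λ ())

-- The diagonal of A² − I lists the degrees minus one.
A²-I : ∀ {n} → SignedGraph n → Mat n
A²-I G = adjMatrix G *ᴹ adjMatrix G -ᴹ 1ᴹ

module _ {k} (G : SignedGraph (suc (suc k))) (connected : Connected G) where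
  private
    A = adjMatrix G
    B = A²-I G
    _∼_ = Adjacent G
  open ≡-Reasoning

  has-neighbour : ∀ u → ∃ λ v → u ∼ v
  has-neighbour u = first-step (connected u (other u)) (other≢ u)
    where
    other : Fin (suc (suc k)) → Fin (suc (suc k))
    other zero    = suc zero
    other (suc _) = zero
    other≢ : ∀ u → other u ≢ u
    other≢ zero    ()
    other≢ (suc _) ()
    first-step : ∀ {u w} → Reachable G u w → w ≢ u → ∃ λ v → u ∼ v
    first-step here         w≢u = contradiction refl w≢u
    first-step (step u∼v _) _   = _ , u∼v

  B-offDiagonal : ∀ {u v} → u ≢ v → B u v ≡ (A *ᴹ A) u v
  B-offDiagonal {u} {v} u≢v = trans (cong (_-_ ((A *ᴹ A) u v)) (δ-≢ u≢v)) (ℤ.+-identityʳ _)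

  B-diagonal : ∀ u → B u u ≡ sum (λ x → A u x * A u x) - 1ℤ
  B-diagonal u = cong₂ _-_ (sum-cong-≗ (λ x → cong (A u x *_) (adjMatrix-sym G x u))) (δ-refl u)

  -- B u u counts the neighbours of u other than v.
  B-diagonal-without : ∀ {u v} → u ∼ v → B u u ≡ sum (λ j → A u (punchIn v j) * A u (punchIn v j))
  B-diagonal-without {u} {v} u∼v = begin
    B u u                                                 ≡⟨ B-diagonal u ⟩
    sum (λ x → A u x * A u x) - 1ℤ                        ≡⟨ cong (_- 1ℤ) (sum-remove {i = v} (λ x → A u x * A u x)) ⟩
    A u v * A u v + sum (λ j → A u (punchIn v j) * A u (punchIn v j)) - 1ℤ
                                                          ≡⟨ cong (λ s → s + rest - 1ℤ) (adjacent⇒square≡1 G u∼v) ⟩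
    1ℤ + sum (λ j → A u (punchIn v j) * A u (punchIn v j)) - 1ℤ ≡⟨ cancel rest ⟩
    sum (λ j → A u (punchIn v j) * A u (punchIn v j))     ∎
    where
    rest = sum (λ j → A u (punchIn v j) * A u (punchIn v j))
    cancel : ∀ s → 1ℤ + s - 1ℤ ≡ s
    cancel = solve-∀

  B-diagonal-nonneg : ∀ u → 0ℤ ≤ B u u
  B-diagonal-nonneg u with has-neighbour u
  ... | v , u∼v = subst (0ℤ ≤_) (sym (B-diagonal-without u∼v)) (sum-nonneg (λ j → A u (punchIn v j) * A u (punchIn v j)) (λ j → square-nonneg (A u (punchIn v j))))

  excess : ℤ → Fin (suc (suc k)) → Fin (suc (suc k)) → Fin (suc (suc k)) → ℤ
  excess ε u v x = A u x * A u x - ε * (A u x * A x v)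

  excess-nonneg : ∀ {ε} → IsSign ε → ∀ u v x → 0ℤ ≤ excess ε u v x
  excess-nonneg ε± u v x = excess-term-nonneg ε± (adjMatrix-entry′ G u x) (adjMatrix-entry′ G x v)

  excess-sum : ∀ ε {u v} → u ∼ v → sum (λ j → excess ε u v (punchIn v j)) ≡ B u u - ε * (A *ᴹ A) u v
  excess-sum ε {u} {v} u∼v = begin
    sum (λ j → excess ε u v (punchIn v j))
      ≡⟨ sum-distrib-minus (λ j → A u (punchIn v j) * A u (punchIn v j)) (λ j → ε * (A u (punchIn v j) * A (punchIn v j) v)) ⟩
    sum (λ j → A u (punchIn v j) * A u (punchIn v j)) - sum (λ j → ε * (A u (punchIn v j) * A (punchIn v j) v))
      ≡⟨ cong₂ _-_ (sym (B-diagonal-without u∼v)) (sym (*-distribˡ-sum ε (λ j → A u (punchIn v j) * A (punchIn v j) v))) ⟩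
    B u u - ε * sum (λ j → A u (punchIn v j) * A (punchIn v j) v)
      ≡⟨ cong (λ s → B u u - ε * s) A²-without-v ⟨
    B u u - ε * (A *ᴹ A) u v ∎
    where
    A²-without-v : (A *ᴹ A) u v ≡ sum (λ j → A u (punchIn v j) * A (punchIn v j) v)
    A²-without-v = begin
      (A *ᴹ A) u v                                                ≡⟨ sum-remove {i = v} (λ x → A u x * A x v) ⟩
      A u v * A v v + sum (λ j → A u (punchIn v j) * A (punchIn v j) v)
        ≡⟨ cong (λ d → A u v * d + sum (λ j → A u (punchIn v j) * A (punchIn v j) v)) (adjMatrix-zeroDiagonal G v) ⟩
      A u v * 0ℤ + sum (λ j → A u (punchIn v j) * A (punchIn v j) v)
        ≡⟨ cong (_+ sum (λ j → A u (punchIn v j) * A (punchIn v j) v)) (ℤ.*-zeroʳ (A u v)) ⟩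
      0ℤ + sum (λ j → A u (punchIn v j) * A (punchIn v j) v)      ≡⟨ ℤ.+-identityˡ _ ⟩
      sum (λ j → A u (punchIn v j) * A (punchIn v j) v)           ∎

  excess-bound : ∀ {ε u v} → IsSign ε → u ∼ v → ε * (A *ᴹ A) u v ≤ B u u
  excess-bound {ε} {u} {v} ε± u∼v = ℤ.0≤i-j⇒j≤i
    (subst (0ℤ ≤_) (excess-sum ε u∼v) (sum-nonneg (λ j → excess ε u v (punchIn v j)) (λ j → excess-nonneg ε± u v (punchIn v j))))

  excess-tight : ∀ {ε u v} → IsSign ε → u ∼ v → ε * (A *ᴹ A) u v ≡ B u u → ∀ x → x ≢ v → excess ε u v x ≡ 0ℤ
  excess-tight {ε} {u} {v} ε± u∼v tight x x≢v = subst (λ y → excess ε u v y ≡ 0ℤ) (punchIn-punchOut v≢x)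
    (sum-nonneg≡0 (λ j → excess ε u v (punchIn v j)) (λ j → excess-nonneg ε± u v (punchIn v j))
      (trans (excess-sum ε u∼v) (trans (cong (_-_ (B u u)) tight) (ℤ.+-inverseʳ (B u u)))) (punchOut v≢x))
    where
    v≢x : v ≢ x
    v≢x = x≢v ∘ sym

  A²-sym : Symmetric (A *ᴹ A)
  A²-sym u w = sum-cong-≗ (λ x → trans (cong₂ _*_ (adjMatrix-sym G u x) (adjMatrix-sym G x w)) (ℤ.*-comm (A x u) (A w x)))

  B-sym : Symmetric B
  B-sym u w = cong₂ _-_ (A²-sym u w) (δ-sym u w)

  module _ (B-idempotent : B *ᴹ B ≈ᴹ trace B •ᴹ B) where

    B-rank-one : ∀ u w → B u w * B u w ≡ B u u * B w w
    B-rank-one = rank-one B B-sym B-idempotent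

    -- A vertex of degree one passes this on to its neighbour, since row u of B vanishes.
    B-diagonal≡0-spreads : ∀ {u v} → u ∼ v → B u u ≡ 0ℤ → B v v ≡ 0ℤ
    B-diagonal≡0-spreads {u} {v} u∼v Buu≡0 = trans (B-diagonal-without (adjacent-sym G u∼v))
      (sum-zero (λ j → A v (punchIn u j) * A v (punchIn u j)) (λ j → cong (λ a → a * a) (A-v≡0 (punchIn u j) (punchInᵢ≢i u j))))
      where
      A-u≡0 : ∀ x → x ≢ v → A u x ≡ 0ℤ
      A-u≡0 x x≢v = subst (λ y → A u y ≡ 0ℤ) (punchIn-punchOut (x≢v ∘ sym))
        (sum-squares≡0 (λ j → A u (punchIn v j)) (trans (sym (B-diagonal-without u∼v)) Buu≡0) (punchOut (x≢v ∘ sym)))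
      B-u≡0 : ∀ w → B u w ≡ 0ℤ
      B-u≡0 w = square≡0 (trans (B-rank-one u w) (trans (cong (_* B w w) Buu≡0) (ℤ.*-zeroˡ (B w w))))
      A-v≡0 : ∀ w → w ≢ u → A v w ≡ 0ℤ
      A-v≡0 w w≢u with ℤ.i*j≡0⇒i≡0∨j≡0 (A u v) product≡0
        where
        product≡0 : A u v * A v w ≡ 0ℤ
        product≡0 = begin
          A u v * A v w     ≡⟨ sum-single v (λ x → A u x * A x w) (λ x x≢v → trans (cong (_* A x w) (A-u≡0 x x≢v)) (ℤ.*-zeroˡ (A x w))) ⟨
          (A *ᴹ A) u w      ≡⟨ B-offDiagonal (w≢u ∘ sym) ⟨
          B u w             ≡⟨ B-u≡0 w ⟩
          0ℤ                ∎
      ... | inj₁ Auv≡0 = contradiction (trans (sym (adjacent⇒square≡1 G u∼v)) (trans (cong (λ a → a * a) Auv≡0) refl)) (λ ())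
      ... | inj₂ Avw≡0 = Avw≡0

    ∣A²∣≤B-diagonal : ∀ {u v} → u ∼ v → + ∣ (A *ᴹ A) u v ∣ ≤ B u u
    ∣A²∣≤B-diagonal {u} {v} u∼v with sign-of ((A *ᴹ A) u v)
    ... | ε , ε± , εβ≡∣β∣ = subst (_≤ B u u) εβ≡∣β∣ (excess-bound ε± u∼v)

    ∣A²∣-square : ∀ {u v} → u ∼ v → + (∣ (A *ᴹ A) u v ∣ ℕ.* ∣ (A *ᴹ A) u v ∣) ≡ B u u * B v v
    ∣A²∣-square {u} {v} u∼v = trans (square-abs ((A *ᴹ A) u v))
      (trans (cong (λ b → b * b) (sym (B-offDiagonal (adjacent⇒≢ G u∼v)))) (B-rank-one u v))

    -- ∣(A²) u v∣ is at most B u u and B v v, and its square is B u u · B v v.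
    adjacent⇒B-diagonal≡ : ∀ {u v} → u ∼ v → B u u ≡ B v v
    adjacent⇒B-diagonal≡ {u} {v} u∼v = equal ∣ (A *ᴹ A) u v ∣ p≤x p≤y p²≡xy
      where
      x = ∣ B u u ∣
      y = ∣ B v v ∣
      Buu≡x : + x ≡ B u u
      Buu≡x = ℤ.0≤i⇒+∣i∣≡i (B-diagonal-nonneg u)
      Bvv≡y : + y ≡ B v v
      Bvv≡y = ℤ.0≤i⇒+∣i∣≡i (B-diagonal-nonneg v)
      p≤x : ∣ (A *ᴹ A) u v ∣ ℕ.≤ x
      p≤x = ℤ.drop‿+≤+ (subst (+ ∣ (A *ᴹ A) u v ∣ ≤_) (sym Buu≡x) (∣A²∣≤B-diagonal u∼v))
      p≤y : ∣ (A *ᴹ A) u v ∣ ℕ.≤ y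
      p≤y = ℤ.drop‿+≤+ (subst₂ (λ a b → + ∣ a ∣ ≤ b) (A²-sym v u) (sym Bvv≡y) (∣A²∣≤B-diagonal (adjacent-sym G u∼v)))
      p²≡xy : ∣ (A *ᴹ A) u v ∣ ℕ.* ∣ (A *ᴹ A) u v ∣ ≡ x ℕ.* y
      p²≡xy = ℤ.+-injective (trans (∣A²∣-square u∼v) (trans (cong₂ _*_ (sym Buu≡x) (sym Bvv≡y)) (sym (ℤ.pos-* x y))))
      equal : ∀ p → p ℕ.≤ x → p ℕ.≤ y → p ℕ.* p ≡ x ℕ.* y → B u u ≡ B v v
      equal zero _ _ 0≡xy with ℕ.m*n≡0⇒m≡0∨n≡0 x (sym 0≡xy)
      ... | inj₁ x≡0 = trans Buu≡0 (sym (B-diagonal≡0-spreads u∼v Buu≡0))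
        where Buu≡0 = trans (sym Buu≡x) (cong +_ x≡0)
      ... | inj₂ y≡0 = trans (B-diagonal≡0-spreads (adjacent-sym G u∼v) Bvv≡0) (sym Bvv≡0)
        where Bvv≡0 = trans (sym Bvv≡y) (cong +_ y≡0)
      equal (suc p) p≤x p≤y p²≡xy = begin
        B u u        ≡⟨ Buu≡x ⟨
        + x          ≡⟨ cong +_ (trans (squeeze (s≤s z≤n) p≤x p≤y p²≡xy)
                                       (sym (squeeze (s≤s z≤n) p≤y p≤x (trans p²≡xy (ℕ.*-comm x y))))) ⟩
        + y          ≡⟨ Bvv≡y ⟩
        B v v        ∎

    B-diagonal-constant : ∀ u → B u u ≡ B zero zero
    B-diagonal-constant u = sym (along (connected zero u))
      where
      along : ∀ {u w} → Reachable G u w → B u u ≡ B w w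
      along here           = refl
      along (step u∼v v⇝w) = trans (adjacent⇒B-diagonal≡ u∼v) (along v⇝w)

    module _ (trace≢0 : trace B ≢ 0ℤ) where

      B-diagonal-positive : ∃ λ t → B zero zero ≡ + suc t
      B-diagonal-positive with ∣ B zero zero ∣ | ℤ.0≤i⇒+∣i∣≡i (B-diagonal-nonneg zero)
      ... | zero  | 0≡B₀₀ = contradiction (sum-zero (λ u → B u u) (λ u → trans (B-diagonal-constant u) (sym 0≡B₀₀))) trace≢0
      ... | suc t | B₀₀≡  = t , sym B₀₀≡

      -- Rank one and the constant diagonal t give ∣(A²) u v∣ = t: the excess bound is attained.
      excess-attained : ∀ {u v} → u ∼ v → ∃ λ ε → IsSign ε × ε * (A *ᴹ A) u v ≡ B u u
      excess-attained {u} {v} u∼v = ε , ε± , (begin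
        ε * β      ≡⟨ εβ≡∣β∣ ⟩
        + ∣ β ∣    ≡⟨ cong +_ ∣β∣≡t ⟩
        + t        ≡⟨ Buu≡t ⟨
        B u u      ∎)
        where
        β = (A *ᴹ A) u v
        ε = proj₁ (sign-of β)
        ε± = proj₁ (proj₂ (sign-of β))
        εβ≡∣β∣ = proj₂ (proj₂ (sign-of β))
        t = suc (proj₁ B-diagonal-positive)
        Buu≡t : B u u ≡ + t
        Buu≡t = trans (B-diagonal-constant u) (proj₂ B-diagonal-positive)
        Bvv≡t : B v v ≡ + t
        Bvv≡t = trans (B-diagonal-constant v) (proj₂ B-diagonal-positive)
        ∣β∣≤t : ∣ β ∣ ℕ.≤ t
        ∣β∣≤t = ℤ.drop‿+≤+ (subst (+ ∣ β ∣ ≤_) Buu≡t (∣A²∣≤B-diagonal u∼v))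
        ∣β∣²≡t² : ∣ β ∣ ℕ.* ∣ β ∣ ≡ t ℕ.* t
        ∣β∣²≡t² = ℤ.+-injective (trans (∣A²∣-square u∼v) (trans (cong₂ _*_ Buu≡t Bvv≡t) (sym (ℤ.pos-* t t))))
        ∣β∣≡t : ∣ β ∣ ≡ t
        ∣β∣≡t = ℕ.≤-antisym ∣β∣≤t (ℕ.≮⇒≥ (λ ∣β∣<t → ℕ.<-irrefl ∣β∣²≡t² (ℕ.*-mono-< ∣β∣<t ∣β∣<t)))

      -- The excess bound is attained, so every excess term vanishes.
      path-sign : ∀ {u v} → u ∼ v → ∃ λ ε → IsSign ε × (∀ x → x ≢ v → u ∼ x → A u x * A x v ≡ ε)
      path-sign {u} {v} u∼v = ε , ε± , λ x x≢v u∼x →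
        tight-term ε± (adjacent⇒square≡1 G u∼x) (excess-tight ε± u∼v attained x x≢v)
        where
        ε = proj₁ (excess-attained u∼v)
        ε± = proj₁ (proj₂ (excess-attained u∼v))
        attained = proj₂ (proj₂ (excess-attained u∼v))

      adjacent-closed : ∀ {u v x} → u ∼ v → x ≢ v → u ∼ x → v ∼ x
      adjacent-closed {u} {v} {x} u∼v x≢v u∼x = adjacent-sym G (nonzero⇒adjacent G A≢0)
        where
        A≢0 : A x v ≢ 0ℤ
        A≢0 A≡0 = sign≢0 (proj₁ (proj₂ (path-sign u∼v)))
          (trans (sym (proj₂ (proj₂ (path-sign u∼v)) x x≢v u∼x)) (trans (cong (A u x *_) A≡0) (ℤ.*-zeroʳ (A u x))))
          where
          sign≢0 : ∀ {s} → IsSign s → s ≢ 0ℤ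
          sign≢0 (inj₁ refl) ()
          sign≢0 (inj₂ refl) ()

      complete : ∀ {u w} → u ≢ w → u ∼ w
      complete {u} {w} u≢w with reach (connected u w)
        where
        reach : ∀ {u w} → Reachable G u w → w ≡ u ⊎ u ∼ w
        reach here = inj₁ refl
        reach {u} {w} (step {v = v} u∼v v⇝w) with reach v⇝w
        ... | inj₁ w≡v = inj₂ (subst (u ∼_) (sym w≡v) u∼v)
        ... | inj₂ v∼w with w ≟ u
        ...   | yes w≡u = inj₁ w≡u
        ...   | no w≢u  = inj₂ (adjacent-closed (adjacent-sym G u∼v) w≢u v∼w)
      ... | inj₁ w≡u = contradiction (sym w≡u) u≢w
      ... | inj₂ u∼w = u∼w

      path₂-constant : ∀ {u w x y} → u ≢ w → x ≢ u → x ≢ w → y ≢ u → y ≢ w → A u x * A x w ≡ A u y * A y w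
      path₂-constant {u} {w} {x} {y} u≢w x≢u x≢w y≢u y≢w =
        trans (paths x x≢w (complete (x≢u ∘ sym))) (sym (paths y y≢w (complete (y≢u ∘ sym))))
        where paths = proj₂ (proj₂ (path-sign (complete u≢w)))

completeGraph-diagonal : ∀ {m} (u : Fin m) → adjMatrix (completeGraph m) u u ≡ 0ℤ
completeGraph-diagonal u with u ≟ u
... | yes _  = refl
... | no u≢u = contradiction refl u≢u

completeGraph-offDiagonal : ∀ {m} {u v : Fin m} → u ≢ v → adjMatrix (completeGraph m) u v ≡ 1ℤ
completeGraph-offDiagonal {u = u} {v} u≢v with u ≟ v
... | yes u≡v = contradiction u≡v u≢v
... | no _    = refl

adjMatrix-negative : ∀ {m} (G : SignedGraph m) u v → adjMatrix (negative G) u v ≡ - adjMatrix G u v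
adjMatrix-negative G u v with adj G u v | sgn G u v
... | false | _   = refl
... | true  | pos = refl
... | true  | neg = refl

private
  switchSign-at : ∀ {x} → IsSign x → signToℤ (switchSign ⌊ x ℤ.≟ - 1ℤ ⌋) ≡ x
  switchSign-at (inj₁ refl) = refl
  switchSign-at (inj₂ refl) = refl

-- Switching at the vertices where s is −1 turns G into ε K_n.
switching-by-signs : ∀ {n} (G : SignedGraph n) (s : Fin n → ℤ) → (∀ u → IsSign (s u)) → ∀ {ε} → IsSign ε →
  (∀ u v → s u * s v * adjMatrix G u v ≡ ε * adjMatrix (completeGraph n) u v) →
  SwitchingIsomorphic G (completeGraph n) ⊎ SwitchingIsomorphic (negative G) (completeGraph n)
switching-by-signs {n} G s s± (inj₁ refl) switched = inj₁ ((λ u → ⌊ s u ℤ.≟ - 1ℤ ⌋) , ⤖-id (Fin n) , λ u v → begin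
  signToℤ (switchSign ⌊ s u ℤ.≟ - 1ℤ ⌋) * signToℤ (switchSign ⌊ s v ℤ.≟ - 1ℤ ⌋) * adjMatrix G u v
    ≡⟨ cong₂ (λ a b → a * b * adjMatrix G u v) (switchSign-at (s± u)) (switchSign-at (s± v)) ⟩
  s u * s v * adjMatrix G u v                     ≡⟨ switched u v ⟩
  1ℤ * adjMatrix (completeGraph n) u v            ≡⟨ ℤ.*-identityˡ _ ⟩
  adjMatrix (completeGraph n) u v                 ∎)
  where open ≡-Reasoning
switching-by-signs {n} G s s± (inj₂ refl) switched = inj₂ ((λ u → ⌊ s u ℤ.≟ - 1ℤ ⌋) , ⤖-id (Fin n) , λ u v → begin
  signToℤ (switchSign ⌊ s u ℤ.≟ - 1ℤ ⌋) * signToℤ (switchSign ⌊ s v ℤ.≟ - 1ℤ ⌋) * adjMatrix (negative G) u v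
    ≡⟨ cong₃ (switchSign-at (s± u)) (switchSign-at (s± v)) (adjMatrix-negative G u v) ⟩
  s u * s v * - adjMatrix G u v                   ≡⟨ pull-neg (s u) (s v) (adjMatrix G u v) ⟩
  - (s u * s v * adjMatrix G u v)                 ≡⟨ cong -_ (switched u v) ⟩
  - (- 1ℤ * adjMatrix (completeGraph n) u v)      ≡⟨ neg-neg (adjMatrix (completeGraph n) u v) ⟩
  adjMatrix (completeGraph n) u v                 ∎)
  where
  open ≡-Reasoning
  cong₃ : ∀ {a a′ b b′ c c′ : ℤ} → a ≡ a′ → b ≡ b′ → c ≡ c′ → a * b * c ≡ a′ * b′ * c′
  cong₃ refl refl refl = refl
  pull-neg : ∀ a b x → a * b * - x ≡ - (a * b * x)
  pull-neg = solve-∀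
  neg-neg : ∀ k → - (- 1ℤ * k) ≡ k
  neg-neg = solve-∀

-- On at least three vertices: completeness and the independence of A u x · A x w from the middle
-- vertex x make all triangles through vertex 0 carry the same sign ε, which a switching normalises.
module _ {k} (G : SignedGraph (suc (suc (suc k))))
  (complete : ∀ {u w} → u ≢ w → Adjacent G u w)
  (path₂-constant : ∀ {u w x y} → u ≢ w → x ≢ u → x ≢ w → y ≢ u → y ≢ w →
                    adjMatrix G u x * adjMatrix G x w ≡ adjMatrix G u y * adjMatrix G y w) where
  private
    A = adjMatrix G
    v₀ v₁ v₂ : Fin (suc (suc (suc k)))
    v₀ = zero
    v₁ = suc zero
    v₂ = suc (suc zero)
  open ≡-Reasoning

  triangle : Fin (suc (suc (suc k))) → Fin (suc (suc (suc k))) → Fin (suc (suc (suc k))) → ℤ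
  triangle u v x = A u v * A v x * A x u

  triangle-swap : ∀ u v x → triangle u v x ≡ triangle u x v
  triangle-swap u v x = begin
    A u v * A v x * A x u     ≡⟨ cong₂ (λ p q → A u v * p * q) (adjMatrix-sym G v x) (adjMatrix-sym G x u) ⟩
    A u v * A x v * A u x     ≡⟨ reverse (A u v) (A x v) (A u x) ⟩
    A u x * A x v * A u v     ≡⟨ cong (A u x * A x v *_) (adjMatrix-sym G u v) ⟩
    A u x * A x v * A v u     ∎
    where
    reverse : ∀ p q r → p * q * r ≡ r * q * p
    reverse = solve-∀

  triangle-third : ∀ {u v v′} → u ≢ v₀ → v ≢ v₀ → v ≢ u → v′ ≢ v₀ → v′ ≢ u → triangle v₀ u v ≡ triangle v₀ u v′
  triangle-third {u} {v} {v′} u≢0 v≢0 v≢u v′≢0 v′≢u = begin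
    A v₀ u * A u v * A v v₀       ≡⟨ ℤ.*-assoc (A v₀ u) _ _ ⟩
    A v₀ u * (A u v * A v v₀)     ≡⟨ cong (A v₀ u *_) (path₂-constant u≢0 v≢u v≢0 v′≢u v′≢0) ⟩
    A v₀ u * (A u v′ * A v′ v₀)   ≡⟨ ℤ.*-assoc (A v₀ u) _ _ ⟨
    A v₀ u * A u v′ * A v′ v₀     ∎

  ε : ℤ
  ε = triangle v₀ v₁ v₂

  triangle≡ε : ∀ {u v} → u ≢ v₀ → v ≢ v₀ → u ≢ v → triangle v₀ u v ≡ ε
  triangle≡ε {u} {v} u≢0 v≢0 u≢v with u ≟ v₁
  ... | yes refl = triangle-third u≢0 v≢0 (u≢v ∘ sym) (λ ()) (λ ())
  ... | no u≢1   = begin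
    triangle v₀ u v     ≡⟨ triangle-third u≢0 v≢0 (u≢v ∘ sym) (λ ()) (u≢1 ∘ sym) ⟩
    triangle v₀ u v₁    ≡⟨ triangle-swap v₀ u v₁ ⟩
    triangle v₀ v₁ u    ≡⟨ triangle-third (λ ()) u≢0 u≢1 (λ ()) (λ ()) ⟩
    ε                   ∎

  private
    A±1 : ∀ {u v} → u ≢ v → IsSign (A u v)
    A±1 = adjacent⇒IsSign G ∘ complete
    A²≡1 : ∀ {u v} → u ≢ v → A u v * A u v ≡ 1ℤ
    A²≡1 = IsSign-square ∘ A±1

  ε± : IsSign ε
  ε± = IsSign-* (IsSign-* (A±1 (λ ())) (A±1 (λ ()))) (A±1 (λ ()))

  -- s u = ε A 0 u makes every edge at 0 carry ε, and then every other edge too, by triangle≡ε.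
  switchingSigns : Fin (suc (suc (suc k))) → ℤ
  switchingSigns zero    = 1ℤ
  switchingSigns (suc u) = ε * A zero (suc u)

  switchingSigns± : ∀ u → IsSign (switchingSigns u)
  switchingSigns± zero    = inj₁ refl
  switchingSigns± (suc u) = IsSign-* ε± (A±1 (λ ()))

  switched-offDiagonal : ∀ {u v} → u ≢ v → switchingSigns u * switchingSigns v * A u v ≡ ε
  switched-offDiagonal {zero}  {zero}  0≢0 = contradiction refl 0≢0
  switched-offDiagonal {zero}  {suc v} _   = begin
    1ℤ * (ε * A v₀ (suc v)) * A v₀ (suc v)   ≡⟨ regroup ε (A v₀ (suc v)) ⟩
    ε * (A v₀ (suc v) * A v₀ (suc v))        ≡⟨ cong (ε *_) (A²≡1 (λ ())) ⟩
    ε * 1ℤ                                   ≡⟨ ℤ.*-identityʳ ε ⟩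
    ε                                        ∎
    where
    regroup : ∀ e a → 1ℤ * (e * a) * a ≡ e * (a * a)
    regroup = solve-∀
  switched-offDiagonal {suc u} {zero}  _   = begin
    ε * A v₀ (suc u) * 1ℤ * A (suc u) v₀     ≡⟨ cong (ε * A v₀ (suc u) * 1ℤ *_) (adjMatrix-sym G (suc u) v₀) ⟩
    ε * A v₀ (suc u) * 1ℤ * A v₀ (suc u)     ≡⟨ regroup ε (A v₀ (suc u)) ⟩
    ε * (A v₀ (suc u) * A v₀ (suc u))        ≡⟨ cong (ε *_) (A²≡1 (λ ())) ⟩
    ε * 1ℤ                                   ≡⟨ ℤ.*-identityʳ ε ⟩
    ε                                        ∎
    where
    regroup : ∀ e a → e * a * 1ℤ * a ≡ e * (a * a)
    regroup = solve-∀
  switched-offDiagonal {suc u} {suc v} u≢v = begin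
    ε * A v₀ (suc u) * (ε * A v₀ (suc v)) * A (suc u) (suc v)
      ≡⟨ cong (λ a → ε * A v₀ (suc u) * (ε * a) * A (suc u) (suc v)) (adjMatrix-sym G v₀ (suc v)) ⟩
    ε * A v₀ (suc u) * (ε * A (suc v) v₀) * A (suc u) (suc v)
      ≡⟨ regroup ε (A v₀ (suc u)) (A (suc v) v₀) (A (suc u) (suc v)) ⟩
    ε * ε * triangle v₀ (suc u) (suc v)
      ≡⟨ cong₂ _*_ (IsSign-square ε±) (triangle≡ε (λ ()) (λ ()) u≢v) ⟩
    1ℤ * ε
      ≡⟨ ℤ.*-identityˡ ε ⟩
    ε ∎
    where
    regroup : ∀ e a b m → e * a * (e * b) * m ≡ e * e * (a * m * b)
    regroup = solve-∀

  switched : ∀ u v → switchingSigns u * switchingSigns v * A u v ≡ ε * adjMatrix (completeGraph (suc (suc (suc k)))) u v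
  switched u v = by-cases (u ≟ v)
    where
    by-cases : Dec (u ≡ v) → switchingSigns u * switchingSigns v * A u v ≡ ε * adjMatrix (completeGraph (suc (suc (suc k)))) u v
    by-cases (yes refl) = trans (cong (switchingSigns u * switchingSigns u *_) (adjMatrix-zeroDiagonal G u))
      (trans (ℤ.*-zeroʳ (switchingSigns u * switchingSigns u)) (sym (trans (cong (ε *_) (completeGraph-diagonal u)) (ℤ.*-zeroʳ ε))))
    by-cases (no u≢v)   = trans (switched-offDiagonal u≢v)
      (sym (trans (cong (ε *_) (completeGraph-offDiagonal u≢v)) (ℤ.*-identityʳ ε)))

  switching-to-complete : SwitchingIsomorphic G (completeGraph (suc (suc (suc k)))) ⊎
                          SwitchingIsomorphic (negative G) (completeGraph (suc (suc (suc k))))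
  switching-to-complete = switching-by-signs G switchingSigns switchingSigns± ε± switched

private
  x²-1≢0 : ∀ {μ} → μ ≢ 1ℤ → μ ≢ - 1ℤ → μ * μ - 1ℤ ≢ 0ℤ
  x²-1≢0 {μ} μ≢1 μ≢-1 μ²-1≡0 with ℤ.i*j≡0⇒i≡0∨j≡0 (μ - 1ℤ) (trans (factor μ) μ²-1≡0)
    where
    factor : ∀ m → (m - 1ℤ) * (m + 1ℤ) ≡ m * m - 1ℤ
    factor = solve-∀
  ... | inj₁ μ-1≡0 = μ≢1 (trans (recover μ) (cong (_+ 1ℤ) μ-1≡0))
    where
    recover : ∀ m → m ≡ m - 1ℤ + 1ℤ
    recover = solve-∀
  ... | inj₂ μ+1≡0 = μ≢-1 (trans (recover μ) (cong (_- 1ℤ) μ+1≡0))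
    where
    recover : ∀ m → m ≡ m + 1ℤ - 1ℤ
    recover = solve-∀

switching-classification : ∀ n (G : SignedGraph n) → Connected G →
  A²-I G *ᴹ A²-I G ≈ᴹ trace (A²-I G) •ᴹ A²-I G → trace (A²-I G) ≢ 0ℤ →
  Σ ℕ λ m → (m ≢ 2) × (SwitchingIsomorphic G (completeGraph m) ⊎ SwitchingIsomorphic (negative G) (completeGraph m))
switching-classification zero G _ _ trace≢0 = contradiction refl trace≢0
switching-classification (suc zero) G _ _ _ = 1 , (λ ()) , switching-by-signs G (λ _ → 1ℤ) (λ _ → inj₁ refl) (inj₁ refl) single
  where
  single : ∀ u v → 1ℤ * 1ℤ * adjMatrix G u v ≡ 1ℤ * adjMatrix (completeGraph 1) u v
  single zero zero = trans (ℤ.*-identityˡ (adjMatrix G zero zero)) (adjMatrix-zeroDiagonal G zero)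
switching-classification (suc (suc zero)) G connected idem trace≢0 =
  contradiction (trans (sym B₀₀≡0) (proj₂ (B-diagonal-positive G connected idem trace≢0))) λ ()
  where
  B₀₀≡0 : A²-I G zero zero ≡ 0ℤ
  B₀₀≡0 = trans (B-diagonal-without G connected {zero} {suc zero} (complete G connected idem trace≢0 {zero} {suc zero} (λ ())))
                (cong (λ a → a * a + 0ℤ) (adjMatrix-zeroDiagonal G zero))
switching-classification (suc (suc (suc k))) G connected idem trace≢0 =
  suc (suc (suc k)) , (λ ()) , switching-to-complete G (complete G connected idem trace≢0) (path₂-constant G connected idem trace≢0)

proposition2p3 : (n : ℕ) (G : SignedGraph n) → Connected G →
    (Σ ℤ λ μ → Σ ℕ λ a → Σ ℕ λ b →
      (suc (a Data.Nat.+ b) ≡ n) × (μ ≢ + 1) × (μ ≢ - (+ 1)) ×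
      (∀ (x : ℤ) → charPoly (adjMatrix G) x ≡ (x - μ) * (x - + 1) ^ a * (x + + 1) ^ b)) →
    Σ ℕ λ m → (m ≢ 2) ×
      (SwitchingIsomorphic G (completeGraph m) ⊎ SwitchingIsomorphic (negative G) (completeGraph m))
proposition2p3 _ G connected (μ , a , b , refl , μ≢1 , μ≢-1 , charPoly≡) = switching-classification _ G connected idem trace≢0
  where
  A-sym = adjMatrix-sym G
  A-zd = adjMatrix-zeroDiagonal G
  trace≡ : trace (A²-I G) ≡ μ * μ - 1ℤ
  trace≡ = trace-A²-I a b μ (adjMatrix G) A-sym A-zd charPoly≡
  idem : A²-I G *ᴹ A²-I G ≈ᴹ trace (A²-I G) •ᴹ A²-I G
  idem i j = trans (A²-I-squared a b μ (adjMatrix G) A-sym A-zd charPoly≡ i j) (cong (_* A²-I G i j) (sym trace≡))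
  trace≢0 : trace (A²-I G) ≢ 0ℤ
  trace≢0 = x²-1≢0 μ≢1 μ≢-1 ∘ trans (sym trace≡)
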